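{- Let $G$ be a $4$-edge-connected graph and $u,v$ two adjacent vertices of $G$. Assume $e_G(v,V(G)\setminus\{u,v\})\ge 3$, and let $va,vb$ be two distinct edges between $v$ and $V(G)\setminus\{u,v\}$ with $a\ne b$. Let $G_1=G-u-v+ab$ (delete $u$ and $v$ and add a new edge $ab$). If $G_1\in\mathcal{S}_3$, then $G\in\mathcal{S}_3$.
   Context: Graphs may have parallel edges but no loops. $e_G(v,X)$ denotes the number of edges between $v$ and the vertex set $X$. $Z(G,\mathbb{Z}_3)$ is the set of $\beta:V(G)\to\mathbb{Z}_3$ with $\sum_v\beta(v)\equiv0\pmod 3$; a $\beta$-orientation is an orientation $D$ with $d^+_D(v)-d^-_D(v)\equiv\beta(v)\pmod 3$ for all $v$; $\mathcal{S}_3$ is the family of graphs admitting a strongly-connected $\beta$-orientation for every $\beta\in Z(G,\mathbb{Z}_3)$. -}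

module Defs where

open import Data.Nat using (ℕ; zero; suc; _+_; _<_; _≤_)
open import Data.Fin using (Fin; _≟_)
open import Data.Integer using (ℤ; +_; _-_)
open import Data.Integer.Divisibility using (_∣_)
open import Data.List using (List; []; _∷_; length; map)
open import Data.List.Relation.Unary.All using (All)
open import Data.List.Membership.Propositional using (_∈_)
open import Data.List.Relation.Binary.Pointwise using (Pointwise)
open import Data.List.Relation.Binary.Sublist.Propositional using (_⊆_)
open import Data.List.Relation.Binary.Permutation.Propositional using (_↭_)
open import Data.Product using (Σ; ∃; _×_; _,_; proj₁; proj₂; map₁; map₂)
open import Data.Sum using (_⊎_)
open import Data.Bool using (Bool; true; false; if_then_else_; _∧_; _∨_; _xor_; not)
open import Function using (_∘_)
open import Function.Definitions using (Injective)
open import Relation.Nullary.Decidable using (⌊_⌋)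
open import Relation.Binary.PropositionalEquality using (_≡_; _≢_)

Edge : ℕ → Set
Edge n = Fin n × Fin n

-- A multigraph on vertex set V(G) = Fin n is the list of its edges;
-- edges are the list positions, so parallel edges are allowed.
-- For an undirected graph the order of the two endpoints is irrelevant.
MGraph : ℕ → Set
MGraph n = List (Edge n)

Loopless : ∀ {n} → MGraph n → Set
Loopless G = All (λ e → proj₁ e ≢ proj₂ e) G

Adjacent : ∀ {n} → MGraph n → Fin n → Fin n → Set
Adjacent G x y = ((x , y) ∈ G) ⊎ ((y , x) ∈ G)

count : ∀ {A : Set} → (A → Bool) → List A → ℕ
count p [] = 0
count p (x ∷ xs) = (if p x then 1 else 0) + count p xs

keep : ∀ {A : Set} → (A → Bool) → List A → List A
keep p [] = []
keep p (x ∷ xs) = if p x then x ∷ keep p xs else keep p xs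

_==_ : ∀ {n} → Fin n → Fin n → Bool
x == y = ⌊ x ≟ y ⌋

data Walk {n : ℕ} (G : MGraph n) : Fin n → Fin n → Set where
  stay : ∀ {x} → Walk G x x
  step : ∀ {x z y} → Adjacent G x z → Walk G z y → Walk G x y

Connected : ∀ {n} → MGraph n → Set
Connected {n} G = ∀ (x y : Fin n) → Walk G x y

-- G is k-edge-connected: deleting fewer than k edges leaves a connected graph
-- (G' ⊆ G as a sublist = G with some edges deleted).
EdgeConnected : ℕ → ∀ {n} → MGraph n → Set
EdgeConnected k G = ∀ G' → G' ⊆ G → length G < length G' + k → Connected G'

data Orients {n : ℕ} : Edge n → Edge n → Set where
  keepDir : ∀ {x y} → Orients (x , y) (x , y)
  flipDir : ∀ {x y} → Orients (y , x) (x , y)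

Orientation : ∀ {n} → MGraph n → MGraph n → Set
Orientation D G = Pointwise Orients D G

outdeg indeg : ∀ {n} → MGraph n → Fin n → ℕ
outdeg D x = count (λ e → proj₁ e == x) D
indeg  D x = count (λ e → proj₂ e == x) D

sumV : ∀ {n} → (Fin n → ℤ) → ℤ
sumV {zero} β = + 0
sumV {suc n} β = β Fin.zero Data.Integer.+ sumV (β ∘ Fin.suc)
  where import Data.Fin as Fin

-- Z(G, ℤ₃): ℤ₃-valued vertex functions are represented by integer-valued
-- ones read modulo 3.
ZeroSum3 : ∀ {n} → (Fin n → ℤ) → Set
ZeroSum3 β = (+ 3) ∣ sumV β

IsβOrientation : ∀ {n} → MGraph n → (Fin n → ℤ) → Set
IsβOrientation D β = ∀ x → (+ 3) ∣ ((+ outdeg D x - + indeg D x) - β x)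

data DPath {n : ℕ} (D : MGraph n) : Fin n → Fin n → Set where
  here : ∀ {x} → DPath D x x
  arc  : ∀ {x z y} → (x , z) ∈ D → DPath D z y → DPath D x y

StronglyConnected : ∀ {n} → MGraph n → Set
StronglyConnected {n} D = ∀ (x y : Fin n) → DPath D x y

InS3 : ∀ {n} → MGraph n → Set
InS3 {n} G = ∀ (β : Fin n → ℤ) → ZeroSum3 β →
  Σ (MGraph n) λ D → Orientation D G × IsβOrientation D β × StronglyConnected D

avoiding : ∀ {n} → Fin n → Fin n → MGraph n → MGraph n
avoiding u v = keep (λ e → not (proj₁ e == u ∨ proj₁ e == v ∨ proj₂ e == u ∨ proj₂ e == v))

-- G₁ (on vertex set Fin k) is G − u − v + ab, up to relabelling: ι identifies
-- Fin k bijectively with V(G) ∖ {u, v}, and relabelling the edges of G₁ by ι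
-- gives exactly the edges of G avoiding u, v plus one new edge ab.
record IsDeleteAdd {n k : ℕ} (G : MGraph n) (u v a b : Fin n)
                   (ι : Fin k → Fin n) (G₁ : MGraph k) : Set where
  field
    ι-injective : Injective _≡_ _≡_ ι
    ι-avoids    : ∀ y → ι y ≢ u × ι y ≢ v
    ι-onto      : ∀ x → x ≢ u → x ≢ v → ∃ λ y → ι y ≡ x
    edges       : map (λ e → ι (proj₁ e) , ι (proj₂ e)) G₁ ↭ ((a , b) ∷ avoiding u v G)

eOut : ∀ {n} → MGraph n → Fin n → Fin n → ℕ
eOut G u v = count (λ e → (proj₁ e == v ∧ not (proj₂ e == u) ∧ not (proj₂ e == v))
                        ∨ (proj₂ e == v ∧ not (proj₁ e == u) ∧ not (proj₁ e == v))) G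

-- First orient every edge at u or v except va and vb: a search modulo 3 finds orientations
-- meeting β at u and at v in which u has an arc in and an arc out; it succeeds because u has at
-- least 4 edges, at least 4 edges leave {u, v}, and v has a third edge leaving {u, v}. The effect of
-- these arcs on the other vertices is absorbed into β₁ ∈ Z(G₁, ℤ₃). In a strongly connected
-- β₁-orientation of G₁ the new edge ab, oriented say a → b, becomes the path a → v → b, which changes
-- no net degree and puts v between vertices of G₁; u hangs on through its arcs in and out.

module Submission where

open import Defs
open import Data.Nat using (ℕ; _≥_)
open import Data.Fin using (Fin)
open import Data.Integer.DivMod using (n%ℕd<d)
open import Relation.Binary.PropositionalEquality using (_≢_)

module Counting where

  open import Data.Nat using (suc; _+_; _≤_; z≤n; s≤s)
  open import Data.Nat.Properties using (+-suc; +-comm; +-assoc; ≤-trans; m≤n+m; m≤n⇒m≤1+n)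
  open import Data.Bool using (Bool; true; false; if_then_else_; not)
  open import Data.List using ([]; _∷_; _++_; length; map)
  open import Data.List.Relation.Unary.All as All using (All; []; _∷_)
  open import Data.List.Relation.Unary.Any using (here; there)
  open import Data.List.Membership.Propositional using (_∈_)
  open import Data.List.Relation.Binary.Sublist.Propositional using (_⊆_)
  open import Data.List.Relation.Binary.Sublist.Heterogeneous using ([]; _∷_; _∷ʳ_)
  open import Data.List.Relation.Binary.Permutation.Propositional as ↭ using (_↭_)
  open import Data.List.Relation.Binary.Permutation.Propositional.Properties using (shift)
  open import Data.List.Membership.Propositional.Properties using (∈-∃++)
  open import Data.Product using (∃; _×_; _,_)
  open import Relation.Binary.PropositionalEquality

  module _ {A : Set} (p : A → Bool) where

    count-++ : ∀ xs ys → count p (xs ++ ys) ≡ count p xs + count p ys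
    count-++ [] ys = refl
    count-++ (x ∷ xs) ys = trans (cong ((if p x then 1 else 0) +_) (count-++ xs ys))
                                 (sym (+-assoc (if p x then 1 else 0) _ _))

    count-↭ : ∀ {xs ys} → xs ↭ ys → count p xs ≡ count p ys
    count-↭ ↭.refl = refl
    count-↭ (↭.prep x xs↭ys) = cong ((if p x then 1 else 0) +_) (count-↭ xs↭ys)
    count-↭ (↭.swap x y xs↭ys) =
      trans (sym (+-assoc (if p x then 1 else 0) _ _))
        (trans (cong₂ _+_ (+-comm (if p x then 1 else 0) _) (count-↭ xs↭ys)) (+-assoc (if p y then 1 else 0) _ _))
    count-↭ (↭.trans xs↭ys ys↭zs) = trans (count-↭ xs↭ys) (count-↭ ys↭zs)

    count-none : ∀ {xs} → All (λ x → p x ≡ false) xs → count p xs ≡ 0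
    count-none [] = refl
    count-none (px≡false ∷ pxs) rewrite px≡false = count-none pxs

    count-all : ∀ {xs} → All (λ x → p x ≡ true) xs → count p xs ≡ length xs
    count-all [] = refl
    count-all (px≡true ∷ pxs) rewrite px≡true = cong suc (count-all pxs)

    count-≡false : (∀ x → p x ≡ false) → ∀ xs → count p xs ≡ 0
    count-≡false p≡false xs = count-none {xs} (All.tabulate (λ {x} _ → p≡false x))

    count-≡true : (∀ x → p x ≡ true) → ∀ xs → count p xs ≡ length xs
    count-≡true p≡true xs = count-all {xs} (All.tabulate (λ {x} _ → p≡true x))

    ∈⇒1≤count : ∀ {x xs} → x ∈ xs → p x ≡ true → 1 ≤ count p xs
    ∈⇒1≤count {xs = y ∷ xs} (here refl) px≡true rewrite px≡true = s≤s z≤n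
    ∈⇒1≤count {xs = y ∷ xs} (there x∈xs) px≡true = ≤-trans (∈⇒1≤count x∈xs px≡true) (m≤n+m _ (if p y then 1 else 0))

    1≤count⇒∃ : ∀ xs → 1 ≤ count p xs → ∃ λ x → x ∈ xs × p x ≡ true
    1≤count⇒∃ (y ∷ xs) 1≤count with p y in py
    ... | true = y , here refl , py
    ... | false with 1≤count⇒∃ xs 1≤count
    ...   | x , x∈xs , px = x , there x∈xs , px

    keep-sound : ∀ {x} xs → x ∈ keep p xs → p x ≡ true
    keep-sound (y ∷ xs) x∈ with p y in py
    keep-sound (y ∷ xs) (here refl) | true = py
    keep-sound (y ∷ xs) (there x∈) | true = keep-sound xs x∈
    keep-sound (y ∷ xs) x∈ | false = keep-sound xs x∈

    keep-All : ∀ xs → All (λ x → p x ≡ true) (keep p xs)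
    keep-All [] = []
    keep-All (y ∷ xs) with p y in py
    ... | true = py ∷ keep-All xs
    ... | false = keep-All xs

    keep-⊆ : ∀ xs → keep p xs ⊆ xs
    keep-⊆ [] = []
    keep-⊆ (y ∷ xs) with p y
    ... | true = refl ∷ keep-⊆ xs
    ... | false = y ∷ʳ keep-⊆ xs

    length≡keep-not+count : ∀ xs → length xs ≡ length (keep (λ x → not (p x)) xs) + count p xs
    length≡keep-not+count [] = refl
    length≡keep-not+count (y ∷ xs) with p y
    ... | true = trans (cong suc (length≡keep-not+count xs)) (sym (+-suc _ _))
    ... | false = cong suc (length≡keep-not+count xs)

  count≤length : ∀ {A : Set} (p : A → Bool) xs → count p xs ≤ length xs
  count≤length p [] = z≤n
  count≤length p (x ∷ xs) with p x
  ... | true = s≤s (count≤length p xs)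
  ... | false = m≤n⇒m≤1+n (count≤length p xs)

  ∈⇒↭∷ : ∀ {A : Set} {x : A} {xs} → x ∈ xs → ∃ λ ys → xs ↭ x ∷ ys
  ∈⇒↭∷ x∈xs with ∈-∃++ x∈xs
  ... | ys , zs , refl = ys ++ zs , shift _ ys zs

  count-map : ∀ {A B : Set} (p : B → Bool) (f : A → B) xs → count p (map f xs) ≡ count (λ x → p (f x)) xs
  count-map p f [] = refl
  count-map p f (x ∷ xs) = cong ((if p (f x) then 1 else 0) +_) (count-map p f xs)

  count-cong : ∀ {A : Set} {p q : A → Bool} → (∀ x → p x ≡ q x) → ∀ xs → count p xs ≡ count q xs
  count-cong p≗q [] = refl
  count-cong {q = q} p≗q (x ∷ xs) rewrite p≗q x = cong ((if q x then 1 else 0) +_) (count-cong p≗q xs)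

module FinEquality where

  open import Data.Fin using (Fin; _≟_)
  open import Data.Bool using (true; false)
  open import Data.Empty using (⊥-elim)
  open import Function.Definitions using (Injective)
  open import Relation.Nullary using (yes; no)
  open import Relation.Binary.PropositionalEquality

  ==-refl : ∀ {n} (x : Fin n) → (x == x) ≡ true
  ==-refl x with x ≟ x
  ... | yes _ = refl
  ... | no x≢x = ⊥-elim (x≢x refl)

  ≢⇒==-false : ∀ {n} {x y : Fin n} → x ≢ y → (x == y) ≡ false
  ≢⇒==-false {x = x} {y} x≢y with x ≟ y
  ... | yes x≡y = ⊥-elim (x≢y x≡y)
  ... | no _ = refl

  ==-true⇒≡ : ∀ {n} {x y : Fin n} → (x == y) ≡ true → x ≡ y
  ==-true⇒≡ {x = x} {y} _ with x ≟ y
  ==-true⇒≡ _ | yes x≡y = x≡y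
  ==-true⇒≡ () | no _

  ==-false⇒≢ : ∀ {n} {x y : Fin n} → (x == y) ≡ false → x ≢ y
  ==-false⇒≢ {x = x} x==x refl rewrite ==-refl x with x==x
  ... | ()

  ==-sym : ∀ {n} (x y : Fin n) → (x == y) ≡ (y == x)
  ==-sym x y with x ≟ y
  ... | yes refl = sym (==-refl x)
  ... | no x≢y = sym (≢⇒==-false (λ y≡x → x≢y (sym y≡x)))

  ==-injective : ∀ {n k} {ι : Fin k → Fin n} → Injective _≡_ _≡_ ι → ∀ x y → (ι x == ι y) ≡ (x == y)
  ==-injective {ι = ι} ι-inj x y with x ≟ y
  ... | yes refl = ==-refl (ι x)
  ... | no x≢y = ≢⇒==-false (λ ιx≡ιy → x≢y (ι-inj ιx≡ιy))

module Splits where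

  open import Data.Nat
  open import Data.Nat.Properties
  open import Data.Nat.DivMod using (_%_; [m+kn]%n≡m%n)
  open import Data.Nat.Induction using (<-rec)
  open import Data.Nat.Tactic.RingSolver using (solve-∀)
  open import Data.List using (foldr; concatMap; map; upTo)
  open import Data.List.Relation.Unary.All using (All; all?; lookup)
  open import Data.List.Membership.Propositional.Properties using (∈-upTo⁺)
  import Data.Maybe
  open import Data.Maybe using (Maybe; nothing; is-just; _<∣>_; to-witness-T)
  open import Data.Product using (_×_; _,_)
  open import Data.Bool using (T)
  open import Data.Unit using (tt)
  open import Relation.Nullary using (Dec; yes; no)
  open import Relation.Nullary.Decidable using (_×-dec_; _→-dec_; T?; toWitness; dec⇒maybe)
  open import Relation.Binary.PropositionalEquality

  -- (pm, qm), (ps, qs), (pr, qr) split the m edges uv, the s other edges at u and the r edges at v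
  -- other than va, vb into arcs leaving and entering u, u, v respectively; i and j are residues of
  -- β(u), β(v), and x + 2y + 2i ≡ 0 (mod 3) encodes x − y ≡ i. Balance at v ignores va and vb: they
  -- will carry the path a → v → b (or its reverse), one arc in and one out.
  record BalancedSplit (m s r i j : ℕ) : Set where
    field
      pm qm ps qs pr qr : ℕ
      m-split : pm + qm ≡ m
      s-split : ps + qs ≡ s
      r-split : pr + qr ≡ r
      u-balanced : (pm + ps + 2 * (qm + qs) + 2 * i) % 3 ≡ 0
      v-balanced : (qm + pr + 2 * (pm + qr) + 2 * j) % 3 ≡ 0
      u-has-out : 1 ≤ pm + ps
      u-has-in : 1 ≤ qm + qs

  Admissible : ℕ → ℕ → ℕ → Set
  Admissible m s r = 1 ≤ m × 1 ≤ r × 4 ≤ m + s × 2 ≤ s + r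

  admissible? : ∀ m s r → Dec (Admissible m s r)
  admissible? m s r = (1 ≤? m) ×-dec (1 ≤? r) ×-dec (4 ≤? m + s) ×-dec (2 ≤? s + r)

  SplitConditions : (m s r i j pm ps pr : ℕ) → Set
  SplitConditions m s r i j pm ps pr =
    pm ≤ m × ps ≤ s × pr ≤ r ×
    (pm + ps + 2 * ((m ∸ pm) + (s ∸ ps)) + 2 * i) % 3 ≡ 0 ×
    ((m ∸ pm) + pr + 2 * (pm + (r ∸ pr)) + 2 * j) % 3 ≡ 0 ×
    1 ≤ pm + ps × 1 ≤ (m ∸ pm) + (s ∸ ps)

  splitConditions? : ∀ m s r i j pm ps pr → Dec (SplitConditions m s r i j pm ps pr)
  splitConditions? m s r i j pm ps pr =
    (pm ≤? m) ×-dec (ps ≤? s) ×-dec (pr ≤? r) ×-dec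
    ((pm + ps + 2 * ((m ∸ pm) + (s ∸ ps)) + 2 * i) % 3 ≟ 0) ×-dec
    (((m ∸ pm) + pr + 2 * (pm + (r ∸ pr)) + 2 * j) % 3 ≟ 0) ×-dec
    (1 ≤? pm + ps) ×-dec (1 ≤? (m ∸ pm) + (s ∸ ps))

  fromSplitConditions : ∀ {m s r i j} pm ps pr → SplitConditions m s r i j pm ps pr → BalancedSplit m s r i j
  fromSplitConditions {m} {s} {r} pm ps pr (pm≤m , ps≤s , pr≤r , u-bal , v-bal , out , in′) = record
    { pm = pm ; qm = m ∸ pm ; ps = ps ; qs = s ∸ ps ; pr = pr ; qr = r ∸ pr
    ; m-split = m+[n∸m]≡n pm≤m ; s-split = m+[n∸m]≡n ps≤s ; r-split = m+[n∸m]≡n pr≤r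
    ; u-balanced = u-bal ; v-balanced = v-bal ; u-has-out = out ; u-has-in = in′ }

  trySplit : ∀ m s r i j → (pm ps pr : ℕ) → Maybe (BalancedSplit m s r i j)
  trySplit m s r i j pm ps pr = Data.Maybe.map (fromSplitConditions pm ps pr) (dec⇒maybe (splitConditions? m s r i j pm ps pr))

  searchSplit : ∀ m s r i j → Maybe (BalancedSplit m s r i j)
  searchSplit m s r i j =
    foldr _<∣>_ nothing
      (concatMap (λ pm → concatMap (λ ps → map (trySplit m s r i j pm ps) (upTo 4)) (upTo 4)) (upTo 4))

  -- Checked by evaluation; balancedSplit reduces larger m, s and r by 3.
  splitsInBox : All (λ m → All (λ s → All (λ r → All (λ i → All (λ j →
                  Admissible m s r → T (is-just (searchSplit m s r i j)))
                (upTo 3)) (upTo 3)) (upTo 5)) (upTo 7)) (upTo 7)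
  splitsInBox = toWitness {a? = all? (λ m → all? (λ s → all? (λ r → all? (λ i → all? (λ j →
                                  admissible? m s r →-dec T? _) _) _) _) _) _} tt

  balancedSplit-small : ∀ {m s r i j} → m < 7 → s < 7 → r < 5 → i < 3 → j < 3 →
    Admissible m s r → BalancedSplit m s r i j
  balancedSplit-small {m} {s} {r} {i} {j} m<7 s<7 r<5 i<3 j<3 adm = to-witness-T _ (found adm)
    where
    found : Admissible m s r → T (is-just (searchSplit m s r i j))
    found = lookup (lookup (lookup (lookup (lookup splitsInBox
              (∈-upTo⁺ m<7)) (∈-upTo⁺ s<7)) (∈-upTo⁺ r<5)) (∈-upTo⁺ i<3)) (∈-upTo⁺ j<3)

  extend-by-3 : ∀ {P : ℕ → Set} b → (∀ {n} → b ≤ n → P n → P (3 + n)) → (∀ {n} → n < 3 + b → P n) →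
    ∀ n → P n
  extend-by-3 {P} b raise small = <-rec P extend
    where
    extend : ∀ n → (∀ {m} → m < n → P m) → P n
    extend n below with n <? 3 + b
    ... | yes n<3+b = small n<3+b
    ... | no n≮3+b = subst P (m+[n∸m]≡n 3≤n) (raise b≤n∸3 (below (∸-monoʳ-< {n} {3} {0} z<s 3≤n)))
      where
      3+b≤n : 3 + b ≤ n
      3+b≤n = ≮⇒≥ n≮3+b
      3≤n : 3 ≤ n
      3≤n = m+n≤o⇒m≤o 3 3+b≤n
      b≤n∸3 : b ≤ n ∸ 3
      b≤n∸3 = m+n≤o⇒m≤o∸n b (subst (_≤ n) (+-comm 3 b) 3+b≤n)

  x+[3+y]≡3+[x+y] : ∀ x y → x + (3 + y) ≡ 3 + (x + y)
  x+[3+y]≡3+[x+y] = solve-∀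

  %3-shift : ∀ {x} y k → x ≡ y + k * 3 → x % 3 ≡ y % 3
  %3-shift y k refl = [m+kn]%n≡m%n y k 3

  -- Three further parallel edges, all oriented the same way, change neither balance modulo 3.
  raise-m : ∀ {m s r i j} → BalancedSplit m s r i j → BalancedSplit (3 + m) s r i j
  raise-m {i = i} {j = j} σ = record
    { pm = pm ; qm = 3 + qm ; ps = ps ; qs = qs ; pr = pr ; qr = qr
    ; s-split = s-split ; r-split = r-split ; u-has-out = u-has-out
    ; m-split = trans (x+[3+y]≡3+[x+y] pm qm) (cong (3 +_) m-split)
    ; u-balanced = trans (%3-shift _ 2 (at-u pm ps qm qs i)) u-balanced
    ; v-balanced = trans (%3-shift _ 1 (at-v qm pr pm qr j)) v-balanced
    ; u-has-in = ≤-trans u-has-in (+-monoˡ-≤ qs (m≤n+m qm 3))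
    }
    where
    open BalancedSplit σ
    at-u : ∀ pm ps qm qs i → pm + ps + 2 * ((3 + qm) + qs) + 2 * i ≡ (pm + ps + 2 * (qm + qs) + 2 * i) + 2 * 3
    at-u = solve-∀
    at-v : ∀ qm pr pm qr j → (3 + qm) + pr + 2 * (pm + qr) + 2 * j ≡ (qm + pr + 2 * (pm + qr) + 2 * j) + 1 * 3
    at-v = solve-∀

  raise-s : ∀ {m s r i j} → BalancedSplit m s r i j → BalancedSplit m (3 + s) r i j
  raise-s {i = i} σ = record
    { pm = pm ; qm = qm ; ps = ps ; qs = 3 + qs ; pr = pr ; qr = qr
    ; m-split = m-split ; r-split = r-split ; v-balanced = v-balanced ; u-has-out = u-has-out
    ; s-split = trans (x+[3+y]≡3+[x+y] ps qs) (cong (3 +_) s-split)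
    ; u-balanced = trans (%3-shift _ 2 (at-u pm ps qm qs i)) u-balanced
    ; u-has-in = ≤-trans u-has-in (+-monoʳ-≤ qm (m≤n+m qs 3))
    }
    where
    open BalancedSplit σ
    at-u : ∀ pm ps qm qs i → pm + ps + 2 * (qm + (3 + qs)) + 2 * i ≡ (pm + ps + 2 * (qm + qs) + 2 * i) + 2 * 3
    at-u = solve-∀

  raise-r : ∀ {m s r i j} → BalancedSplit m s r i j → BalancedSplit m s (3 + r) i j
  raise-r {j = j} σ = record
    { pm = pm ; qm = qm ; ps = ps ; qs = qs ; pr = pr ; qr = 3 + qr
    ; m-split = m-split ; s-split = s-split ; u-balanced = u-balanced ; u-has-out = u-has-out ; u-has-in = u-has-in
    ; r-split = trans (x+[3+y]≡3+[x+y] pr qr) (cong (3 +_) r-split)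
    ; v-balanced = trans (%3-shift _ 2 (at-v qm pr pm qr j)) v-balanced
    }
    where
    open BalancedSplit σ
    at-v : ∀ qm pr pm qr j → qm + pr + 2 * (pm + (3 + qr)) + 2 * j ≡ (qm + pr + 2 * (pm + qr) + 2 * j) + 2 * 3
    at-v = solve-∀

  balancedSplit : ∀ {i j} → i < 3 → j < 3 → ∀ m s r → Admissible m s r → BalancedSplit m s r i j
  balancedSplit {i} {j} i<3 j<3 = extend-by-3 4 raise-m-step (λ m<7 →
                                  extend-by-3 4 raise-s-step (λ s<7 →
                                  extend-by-3 2 raise-r-step (λ r<5 →
                                  balancedSplit-small m<7 s<7 r<5 i<3 j<3)))
    where
    raise-m-step : ∀ {m} → 4 ≤ m → (∀ s r → Admissible m s r → BalancedSplit m s r i j) →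
      ∀ s r → Admissible (3 + m) s r → BalancedSplit (3 + m) s r i j
    raise-m-step {m} 4≤m split s r (_ , 1≤r , _ , 2≤s+r) =
      raise-m (split s r (≤-trans (s≤s z≤n) 4≤m , 1≤r , ≤-trans 4≤m (m≤m+n m s) , 2≤s+r))
    raise-s-step : ∀ {m s} → 4 ≤ s → (∀ r → Admissible m s r → BalancedSplit m s r i j) →
      ∀ r → Admissible m (3 + s) r → BalancedSplit m (3 + s) r i j
    raise-s-step {m} {s} 4≤s split r (1≤m , 1≤r , _ , _) =
      raise-s (split r (1≤m , 1≤r , ≤-trans 4≤s (m≤n+m s m) , ≤-trans (≤-trans (s≤s (s≤s z≤n)) 4≤s) (m≤m+n s r)))
    raise-r-step : ∀ {m s r} → 2 ≤ r → (Admissible m s r → BalancedSplit m s r i j) →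
      Admissible m s (3 + r) → BalancedSplit m s (3 + r) i j
    raise-r-step {m} {s} {r} 2≤r split (1≤m , _ , 4≤m+s , _) =
      raise-r (split (1≤m , ≤-trans (s≤s z≤n) 2≤r , 4≤m+s , ≤-trans 2≤r (m≤n+m r s)))

module Residues where

  import Data.Nat as ℕ
  import Data.Nat.DivMod as ℕ
  open import Data.Integer as ℤ using (ℤ; +_; _+_; _-_; _%ℕ_; _/ℕ_)
  open import Data.Integer.Properties using (pos-+; pos-*)
  open import Data.Integer.DivMod using (a≡a%ℕn+[a/ℕn]*n)
  open import Data.Integer.Divisibility.Signed using (_∣_; divides)
  open import Data.Integer.Tactic.RingSolver using (solve-∀)
  open import Relation.Binary.PropositionalEquality
  open ≡-Reasoning

  balanced⇒∣ : ∀ x y β → (x ℕ.+ 2 ℕ.* y ℕ.+ 2 ℕ.* (β %ℕ 3)) ℕ.% 3 ≡ 0 → + 3 ∣ (+ x - + y) - β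
  balanced⇒∣ x y β balanced = divides (+ t - + y - + i - q) (begin
    (+ x - + y) - β                                        ≡⟨ cong (_-_ (+ x - + y)) (a≡a%ℕn+[a/ℕn]*n β 3) ⟩
    (+ x - + y) - (+ i + q ℤ.* + 3)                        ≡⟨ regroup (+ x) (+ y) (+ i) q ⟩
    (+ x + + 2 ℤ.* + y + + 2 ℤ.* + i) - + 3 ℤ.* + y - + 3 ℤ.* + i - q ℤ.* + 3
                                                           ≡⟨ cong (λ z → z - + 3 ℤ.* + y - + 3 ℤ.* + i - q ℤ.* + 3) multiple-of-3 ⟩
    + t ℤ.* + 3 - + 3 ℤ.* + y - + 3 ℤ.* + i - q ℤ.* + 3   ≡⟨ factor (+ t) (+ y) (+ i) q ⟩
    (+ t - + y - + i - q) ℤ.* + 3                          ∎)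
    where
    i N t : ℕ.ℕ
    i = β %ℕ 3
    N = x ℕ.+ 2 ℕ.* y ℕ.+ 2 ℕ.* i
    t = N ℕ./ 3
    q : ℤ
    q = β /ℕ 3
    multiple-of-3 : + x + + 2 ℤ.* + y + + 2 ℤ.* + i ≡ + t ℤ.* + 3
    multiple-of-3 = begin
      + x + + 2 ℤ.* + y + + 2 ℤ.* + i   ≡⟨ cong₂ (λ p r → + x + p + r) (sym (pos-* 2 y)) (sym (pos-* 2 i)) ⟩
      + x + + (2 ℕ.* y) + + (2 ℕ.* i)   ≡⟨ cong (_+ + (2 ℕ.* i)) (sym (pos-+ x (2 ℕ.* y))) ⟩
      + (x ℕ.+ 2 ℕ.* y) + + (2 ℕ.* i)   ≡⟨ sym (pos-+ (x ℕ.+ 2 ℕ.* y) (2 ℕ.* i)) ⟩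
      + N                               ≡⟨ cong +_ (trans (ℕ.m≡m%n+[m/n]*n N 3) (cong (ℕ._+ t ℕ.* 3) balanced)) ⟩
      + (t ℕ.* 3)                       ≡⟨ pos-* t 3 ⟩
      + t ℤ.* + 3                       ∎
    regroup : ∀ a b c d → (a - b) - (c + d ℤ.* + 3) ≡ (a + + 2 ℤ.* b + + 2 ℤ.* c) - + 3 ℤ.* b - + 3 ℤ.* c - d ℤ.* + 3
    regroup = solve-∀
    factor : ∀ a b c d → a ℤ.* + 3 - + 3 ℤ.* b - + 3 ℤ.* c - d ℤ.* + 3 ≡ (a - b - c - d) ℤ.* + 3
    factor = solve-∀

module VertexSums where

  open Counting
  open FinEquality
  open import Data.Nat as ℕ using (ℕ; zero; suc)
  open import Data.Fin as F using (Fin; _≟_)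
  open import Data.Integer hiding (_≟_)
  open import Data.Integer.Properties
    using (+-0-commutativeMonoid; +-*-semiring; pos-+; neg-distrib-+; +-inverseʳ; *-identityˡ; *-identityʳ; *-zeroˡ; +-identityˡ; +-identityʳ)
  open import Data.Integer.Tactic.RingSolver using (solve-∀)
  open import Algebra.Properties.CommutativeMonoid.Sum +-0-commutativeMonoid
    using (sum; ∑-distrib-+; ∑-comm; sum-cong-≗; sum-replicate-zero)
  open import Algebra.Properties.Semiring.Sum +-*-semiring using (*-distribʳ-sum)
  open import Data.Bool using (Bool; if_then_else_)
  open import Data.Product using (∃; _×_; _,_; proj₁; proj₂)
  open import Function using (_∘_)
  open import Function.Definitions using (Injective)
  open import Relation.Nullary using (yes; no)
  open import Relation.Binary.PropositionalEquality
  open ≡-Reasoning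

  sumV≡sum : ∀ {n} (f : Fin n → ℤ) → sumV f ≡ sum f
  sumV≡sum {zero} f = refl
  sumV≡sum {suc n} f = cong (_+_ (f F.zero)) (sumV≡sum (f ∘ F.suc))

  sum-neg : ∀ {n} (f : Fin n → ℤ) → sum (λ x → - f x) ≡ - sum f
  sum-neg {zero} f = refl
  sum-neg {suc n} f = trans (cong (_+_ (- f F.zero)) (sum-neg (f ∘ F.suc))) (sym (neg-distrib-+ (f F.zero) _))

  sum-− : ∀ {n} (f g : Fin n → ℤ) → sum (λ x → f x - g x) ≡ sum f - sum g
  sum-− f g = trans (∑-distrib-+ f (λ x → - g x)) (cong (_+_ (sum f)) (sum-neg g))

  indicator : Bool → ℤ
  indicator b = + (if b then 1 else 0)

  δ : ∀ {n} → Fin n → Fin n → ℤ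
  δ c x = indicator (c == x)

  ==-suc : ∀ {n} (c x : Fin n) → (F.suc c == F.suc x) ≡ (c == x)
  ==-suc c x with c ≟ x
  ... | yes _ = refl
  ... | no _ = refl

  sum-δ* : ∀ {n} (c : Fin n) (f : Fin n → ℤ) → sum (λ x → δ c x * f x) ≡ f c
  sum-δ* {suc n} F.zero f = begin
    + 1 * f F.zero + sum (λ x → + 0 * f (F.suc x)) ≡⟨ cong₂ _+_ (*-identityˡ (f F.zero)) (sum-cong-≗ (λ x → *-zeroˡ (f (F.suc x)))) ⟩
    f F.zero + sum {n} (λ _ → + 0)                 ≡⟨ cong (_+_ (f F.zero)) (sum-replicate-zero n) ⟩
    f F.zero + + 0                                 ≡⟨ +-identityʳ _ ⟩
    f F.zero                                       ∎
  sum-δ* {suc n} (F.suc c) f = begin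
    + 0 * f F.zero + sum (λ x → δ (F.suc c) (F.suc x) * f (F.suc x)) ≡⟨ cong₂ _+_ (*-zeroˡ (f F.zero))
                                                                         (sum-cong-≗ (λ x → cong (λ b → indicator b * f (F.suc x)) (==-suc c x))) ⟩
    + 0 + sum (λ x → δ c x * f (F.suc x))                             ≡⟨ +-identityˡ _ ⟩
    sum (λ x → δ c x * f (F.suc x))                                   ≡⟨ sum-δ* c (f ∘ F.suc) ⟩
    f (F.suc c)                                                       ∎

  sum-δ : ∀ {n} (c : Fin n) → sum (δ c) ≡ + 1
  sum-δ c = trans (sum-cong-≗ (λ x → sym (*-identityʳ (δ c x)))) (sum-δ* c (λ _ → + 1))

  module _ {n k : ℕ} {u v : Fin n} (u≢v : u ≢ v) {ι : Fin k → Fin n}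
           (ι-injective : Injective _≡_ _≡_ ι) (ι-avoids : ∀ y → ι y ≢ u × ι y ≢ v)
           (ι-onto : ∀ x → x ≢ u → x ≢ v → ∃ λ y → ι y ≡ x) where

    sum-δ∘ι : ∀ x → sum (λ y → δ (ι y) x) ≡ + 1 - δ u x - δ v x
    sum-δ∘ι x with x ≟ u
    ... | yes refl = begin
        sum (λ y → δ (ι y) u) ≡⟨ sum-cong-≗ (λ y → cong indicator (≢⇒==-false (proj₁ (ι-avoids y)))) ⟩
        sum {k} (λ _ → + 0)   ≡⟨ sum-replicate-zero k ⟩
        + 0                   ≡⟨⟩
        + 1 - + 1 - + 0       ≡⟨ cong₂ (λ p q → + 1 - indicator p - indicator q)
                                    (sym (==-refl u)) (sym (≢⇒==-false (≢-sym u≢v))) ⟩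
        + 1 - δ u u - δ v u   ∎
    ... | no x≢u with x ≟ v
    ...   | yes refl = begin
        sum (λ y → δ (ι y) v) ≡⟨ sum-cong-≗ (λ y → cong indicator (≢⇒==-false (proj₂ (ι-avoids y)))) ⟩
        sum {k} (λ _ → + 0)   ≡⟨ sum-replicate-zero k ⟩
        + 0                   ≡⟨⟩
        + 1 - + 0 - + 1       ≡⟨ cong₂ (λ p q → + 1 - indicator p - indicator q)
                                    (sym (≢⇒==-false u≢v)) (sym (==-refl v)) ⟩
        + 1 - δ u v - δ v v   ∎
    ...   | no x≢v with ι-onto x x≢u x≢v
    ...     | y₀ , refl = begin
        sum (λ y → δ (ι y) (ι y₀))            ≡⟨ sum-cong-≗ (λ y → trans (cong indicator (==-injective ι-injective y y₀))
                                                                        (sym (*-identityʳ _))) ⟩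
        sum (λ y → δ y y₀ * + 1)             ≡⟨ sum-cong-≗ (λ y → cong (λ b → indicator b * + 1) (==-sym y y₀)) ⟩
        sum (λ y → δ y₀ y * + 1)             ≡⟨ sum-δ* y₀ (λ _ → + 1) ⟩
        + 1                                   ≡⟨⟩
        + 1 - + 0 - + 0                       ≡⟨ cong₂ (λ p q → + 1 - indicator p - indicator q)
                                                   (sym (≢⇒==-false (≢-sym x≢u))) (sym (≢⇒==-false (≢-sym x≢v))) ⟩
        + 1 - δ u (ι y₀) - δ v (ι y₀)        ∎

    -- δ turns a sum over Fin k into a double sum whose order can be swapped.
    sum∘ι≡sum-at-u-at-v : (f : Fin n → ℤ) → sum (λ y → f (ι y)) ≡ sum f - f u - f v
    sum∘ι≡sum-at-u-at-v f = begin
      sum (λ y → f (ι y))                                     ≡⟨ sum-cong-≗ (λ y → sym (sum-δ* (ι y) f)) ⟩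
      sum (λ y → sum (λ x → δ (ι y) x * f x))                 ≡⟨ ∑-comm (λ y x → δ (ι y) x * f x) ⟩
      sum (λ x → sum (λ y → δ (ι y) x * f x))                 ≡⟨ sum-cong-≗ (λ x → sym (*-distribʳ-sum (f x) (λ y → δ (ι y) x))) ⟩
      sum (λ x → sum (λ y → δ (ι y) x) * f x)                 ≡⟨ sum-cong-≗ (λ x → trans (cong (_* f x) (sum-δ∘ι x)) (distrib (δ u x) (δ v x) (f x))) ⟩
      sum (λ x → f x - δ u x * f x - δ v x * f x)             ≡⟨ sum-− (λ x → f x - δ u x * f x) (λ x → δ v x * f x) ⟩
      sum (λ x → f x - δ u x * f x) - sum (λ x → δ v x * f x) ≡⟨ cong (_- sum (λ x → δ v x * f x)) (sum-− f (λ x → δ u x * f x)) ⟩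
      sum f - sum (λ x → δ u x * f x) - sum (λ x → δ v x * f x) ≡⟨ cong₂ (λ p q → sum f - p - q) (sum-δ* u f) (sum-δ* v f) ⟩
      sum f - f u - f v                                       ∎
      where
      distrib : ∀ a b c → (+ 1 - a - b) * c ≡ c - a * c - b * c
      distrib = solve-∀

module Orientations where

  open Counting
  open import Data.Nat using (_+_; _≤_; _<_; _≤?_)
  open import Data.Nat.Properties using (+-monoʳ-<; ≰⇒>)
  open import Data.Fin using (Fin)
  open import Data.Bool using (Bool; true; false; not; _xor_)
  open import Data.Empty using (⊥-elim)
  open import Data.List using ([]; _∷_; _++_; length; map)
  open import Data.List.Membership.Propositional using (_∈_)
  import Data.List.Relation.Unary.All as All
  open import Data.List.Relation.Binary.Pointwise using ([]; _∷_)
  open import Data.List.Relation.Binary.Permutation.Propositional as ↭ using (_↭_)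
  open import Data.Product using (Σ; ∃; _×_; _,_)
  open import Data.Sum using (_⊎_; inj₁; inj₂)
  open import Relation.Nullary using (yes; no)
  open import Relation.Binary.PropositionalEquality

  orientation-↭ : ∀ {n} {G H D : MGraph n} → G ↭ H → Orientation D G →
    Σ (MGraph n) λ D′ → Orientation D′ H × D′ ↭ D
  orientation-↭ ↭.refl o = _ , o , ↭.refl
  orientation-↭ (↭.prep _ G↭H) (o ∷ os) with orientation-↭ G↭H os
  ... | _ , os′ , D′↭D = _ , o ∷ os′ , ↭.prep _ D′↭D
  orientation-↭ (↭.swap _ _ G↭H) (o₁ ∷ o₂ ∷ os) with orientation-↭ G↭H os
  ... | _ , os′ , D′↭D = _ , o₂ ∷ o₁ ∷ os′ , ↭.swap _ _ D′↭D
  orientation-↭ (↭.trans G↭H H↭K) o with orientation-↭ G↭H o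
  ... | _ , o′ , D′↭D with orientation-↭ H↭K o′
  ... | _ , o″ , D″↭D′ = _ , o″ , ↭.trans D″↭D′ D′↭D

  adjacent⇒≢ : ∀ {n} {G : MGraph n} → Loopless G → ∀ {x y} → Adjacent G x y → x ≢ y
  adjacent⇒≢ loopless (inj₁ xy∈G) = All.lookup loopless xy∈G
  adjacent⇒≢ loopless (inj₂ yx∈G) = ≢-sym (All.lookup loopless yx∈G)

  relabel : ∀ {n k} → (Fin k → Fin n) → Edge k → Edge n
  relabel f (x , y) = f x , f y

  orientation-map : ∀ {n k} (f : Fin k → Fin n) {D G : MGraph k} → Orientation D G →
    Orientation (map (relabel f) D) (map (relabel f) G)
  orientation-map f [] = []
  orientation-map f (keepDir ∷ os) = keepDir ∷ orientation-map f os
  orientation-map f (flipDir ∷ os) = flipDir ∷ orientation-map f os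

  orientation-++ : ∀ {n} {D₁ G₁ D₂ G₂ : MGraph n} → Orientation D₁ G₁ → Orientation D₂ G₂ →
    Orientation (D₁ ++ D₂) (G₁ ++ G₂)
  orientation-++ [] o₂ = o₂
  orientation-++ (o ∷ os) o₂ = o ∷ orientation-++ os o₂

  infixr 5 _++ᵖ_
  _++ᵖ_ : ∀ {n} {D : MGraph n} {x y z} → DPath D x y → DPath D y z → DPath D x z
  here ++ᵖ q = q
  arc e p ++ᵖ q = arc e (p ++ᵖ q)

  arc⇒path : ∀ {n} {D : MGraph n} {x y} → (x , y) ∈ D → DPath D x y
  arc⇒path e = arc e here

  DPath-⊆ : ∀ {n} {D D′ : MGraph n} → (∀ {e} → e ∈ D → e ∈ D′) → ∀ {x y} → DPath D x y → DPath D′ x y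
  DPath-⊆ D⊆D′ here = here
  DPath-⊆ D⊆D′ (arc e p) = arc (D⊆D′ e) (DPath-⊆ D⊆D′ p)

  DPath-attach : ∀ {n} {D : MGraph n} (P : Fin n → Set) (w : Fin n) →
    (∀ {x y} → P x → P y → DPath D x y) →
    (∃ λ z → (w , z) ∈ D × P z) → (∃ λ z → (z , w) ∈ D × P z) →
    ∀ {x y} → P x ⊎ x ≡ w → P y ⊎ y ≡ w → DPath D x y
  DPath-attach P w reach _ _ (inj₁ Px) (inj₁ Py) = reach Px Py
  DPath-attach P w reach (z , wz∈D , Pz) _ (inj₂ refl) (inj₁ Py) = arc wz∈D (reach Pz Py)
  DPath-attach P w reach _ (z , zw∈D , Pz) (inj₁ Px) (inj₂ refl) = reach Px Pz ++ᵖ arc⇒path zw∈D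
  DPath-attach P w reach _ _ (inj₂ refl) (inj₂ refl) = here

  crosses : ∀ {n} → (Fin n → Bool) → Edge n → Bool
  crosses S (x , y) = S x xor S y

  not-xor⇒≡ : ∀ {a b} → not (a xor b) ≡ true → a ≡ b
  not-xor⇒≡ {false} {false} _ = refl
  not-xor⇒≡ {true} {true} _ = refl

  walk-preserves : ∀ {n} (S : Fin n → Bool) {G : MGraph n} →
    (∀ {e} → e ∈ G → not (crosses S e) ≡ true) → ∀ {x y} → Walk G x y → S x ≡ S y
  walk-preserves S no-crossing stay = refl
  walk-preserves S no-crossing (step (inj₁ xz∈G) w) = trans (not-xor⇒≡ (no-crossing xz∈G)) (walk-preserves S no-crossing w)
  walk-preserves S no-crossing (step (inj₂ zx∈G) w) = trans (sym (not-xor⇒≡ (no-crossing zx∈G))) (walk-preserves S no-crossing w)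

  -- Deleting the crossing edges would disconnect x from y.
  edgeConnected⇒cut≥ : ∀ {n} k (G : MGraph n) → EdgeConnected k G → (S : Fin n → Bool) → ∀ x y →
    S x ≡ true → S y ≡ false → k ≤ count (crosses S) G
  edgeConnected⇒cut≥ k G ec S x y Sx Sy with k ≤? count (crosses S) G
  ... | yes k≤cut = k≤cut
  ... | no k≰cut = ⊥-elim (true≢false (trans (sym Sx) (trans (walk-preserves S (keep-sound _ G) (ec G′ (keep-⊆ _ G) shorter x y)) Sy)))
    where
    true≢false : true ≢ false
    true≢false ()
    G′ : MGraph _
    G′ = keep (λ e → not (crosses S e)) G
    shorter : length G < length G′ + k
    shorter = subst (_< length G′ + k) (sym (length≡keep-not+count (crosses S) G)) (+-monoʳ-< (length G′) (≰⇒> k≰cut))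

module NetDegrees where

  open Counting
  open FinEquality
  import Data.Integer.Properties
  open VertexSums using (indicator; δ; sum-δ; sum-−)
  open import Algebra.Properties.CommutativeMonoid.Sum Data.Integer.Properties.+-0-commutativeMonoid
    using (sum; ∑-distrib-+; sum-cong-≗; sum-replicate-zero)
  open Orientations using (relabel)
  open import Data.Nat as ℕ using (ℕ)
  open import Data.Fin using (Fin)
  open import Data.Bool using (if_then_else_)
  open import Data.Integer using (ℤ; +_; _+_; _-_; -_)
  open import Data.Integer.Properties using (pos-+; +-inverseʳ)
  open import Data.Integer.Tactic.RingSolver using (solve-∀)
  open import Data.List using ([]; _∷_; _++_; length; map)
  open import Data.List.Relation.Binary.Permutation.Propositional using (_↭_)
  open import Data.Product using (_,_; proj₁; proj₂)
  open import Function.Definitions using (Injective)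
  open import Relation.Binary.PropositionalEquality
  open ≡-Reasoning

  netDegree : ∀ {n} → MGraph n → Fin n → ℤ
  netDegree D x = + outdeg D x - + indeg D x

  arcNet : ∀ {n} → Fin n → Edge n → ℤ
  arcNet x (p , q) = indicator (p == x) - indicator (q == x)

  netDegree-∷ : ∀ {n} (e : Edge n) D x → netDegree (e ∷ D) x ≡ arcNet x e + netDegree D x
  netDegree-∷ (p , q) D x = begin
    + (i ℕ.+ o) - + (j ℕ.+ k)        ≡⟨ cong₂ _-_ (pos-+ i o) (pos-+ j k) ⟩
    (+ i + + o) - (+ j + + k)        ≡⟨ regroup (+ i) (+ o) (+ j) (+ k) ⟩
    (+ i - + j) + (+ o - + k)        ∎
    where
    i j o k : ℕ
    i = if p == x then 1 else 0
    j = if q == x then 1 else 0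
    o = outdeg D x
    k = indeg D x
    regroup : ∀ a b c d → (a + b) - (c + d) ≡ (a - c) + (b - d)
    regroup = solve-∀

  netDegree-++ : ∀ {n} (D₁ D₂ : MGraph n) x → netDegree (D₁ ++ D₂) x ≡ netDegree D₁ x + netDegree D₂ x
  netDegree-++ [] D₂ x = sym (Data.Integer.Properties.+-identityˡ _)
  netDegree-++ (e ∷ D₁) D₂ x = begin
    netDegree (e ∷ D₁ ++ D₂) x                       ≡⟨ netDegree-∷ e (D₁ ++ D₂) x ⟩
    arcNet x e + netDegree (D₁ ++ D₂) x              ≡⟨ cong (_+_ (arcNet x e)) (netDegree-++ D₁ D₂ x) ⟩
    arcNet x e + (netDegree D₁ x + netDegree D₂ x)   ≡⟨ sym (Data.Integer.Properties.+-assoc (arcNet x e) _ _) ⟩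
    (arcNet x e + netDegree D₁ x) + netDegree D₂ x   ≡⟨ cong (_+ netDegree D₂ x) (sym (netDegree-∷ e D₁ x)) ⟩
    netDegree (e ∷ D₁) x + netDegree D₂ x            ∎

  netDegree-↭ : ∀ {n} {D D′ : MGraph n} → D ↭ D′ → ∀ x → netDegree D x ≡ netDegree D′ x
  netDegree-↭ D↭D′ x = cong₂ (λ o i → + o - + i) (count-↭ (λ e → proj₁ e == x) D↭D′) (count-↭ (λ e → proj₂ e == x) D↭D′)

  netDegree-subdivide : ∀ {n} (p w q : Fin n) D x → netDegree ((p , w) ∷ (w , q) ∷ D) x ≡ netDegree ((p , q) ∷ D) x
  netDegree-subdivide p w q D x = begin
    netDegree ((p , w) ∷ (w , q) ∷ D) x                          ≡⟨ netDegree-∷ (p , w) ((w , q) ∷ D) x ⟩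
    arcNet x (p , w) + netDegree ((w , q) ∷ D) x                 ≡⟨ cong (_+_ (arcNet x (p , w))) (netDegree-∷ (w , q) D x) ⟩
    arcNet x (p , w) + (arcNet x (w , q) + netDegree D x)        ≡⟨ cancel (indicator (p == x)) (indicator (w == x)) (indicator (q == x)) _ ⟩
    arcNet x (p , q) + netDegree D x                             ≡⟨ sym (netDegree-∷ (p , q) D x) ⟩
    netDegree ((p , q) ∷ D) x                                    ∎
    where
    cancel : ∀ a b c d → (a - b) + ((b - c) + d) ≡ (a - c) + d
    cancel = solve-∀

  netDegree-relabel : ∀ {n k} {ι : Fin k → Fin n} → Injective _≡_ _≡_ ι → ∀ D y →
    netDegree (map (relabel ι) D) (ι y) ≡ netDegree D y
  netDegree-relabel {ι = ι} ι-injective D y = cong₂ (λ o i → + o - + i)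
    (trans (count-map _ (relabel ι) D) (count-cong (λ e → ==-injective ι-injective (proj₁ e) y) D))
    (trans (count-map _ (relabel ι) D) (count-cong (λ e → ==-injective ι-injective (proj₂ e) y) D))

  netDegree-relabel-outside : ∀ {n k} {ι : Fin k → Fin n} {x} → (∀ y → ι y ≢ x) → ∀ D →
    netDegree (map (relabel ι) D) x ≡ + 0
  netDegree-relabel-outside {ι = ι} ι≢x D = cong₂ (λ o i → + o - + i)
    (trans (count-map _ (relabel ι) D) (count-≡false _ (λ e → ≢⇒==-false (ι≢x (proj₁ e))) D))
    (trans (count-map _ (relabel ι) D) (count-≡false _ (λ e → ≢⇒==-false (ι≢x (proj₂ e))) D))

  sum-count≡length : ∀ {n} (h : Edge n → Fin n) (D : MGraph n) → sum (λ x → + count (λ e → h e == x) D) ≡ + length D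
  sum-count≡length {n} h [] = sum-replicate-zero n
  sum-count≡length h (e ∷ D) = begin
    sum (λ x → + count (λ e → h e == x) (e ∷ D))              ≡⟨ sum-cong-≗ (λ x → pos-+ _ (count (λ e → h e == x) D)) ⟩
    sum (λ x → δ (h e) x + + count (λ e → h e == x) D)        ≡⟨ ∑-distrib-+ (δ (h e)) _ ⟩
    sum (δ (h e)) + sum (λ x → + count (λ e → h e == x) D)    ≡⟨ cong₂ _+_ (sum-δ (h e)) (sum-count≡length h D) ⟩
    + 1 + + length D                                          ≡⟨ sym (pos-+ 1 (length D)) ⟩
    + length (e ∷ D)                                          ∎

  sum-netDegree≡0 : ∀ {n} (D : MGraph n) → sum (netDegree D) ≡ + 0
  sum-netDegree≡0 D = begin
    sum (netDegree D)                                   ≡⟨ sum-− (λ x → + outdeg D x) (λ x → + indeg D x) ⟩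
    sum (λ x → + outdeg D x) - sum (λ x → + indeg D x) ≡⟨ cong₂ _-_ (sum-count≡length proj₁ D) (sum-count≡length proj₂ D) ⟩
    + length D - + length D                      ≡⟨ +-inverseʳ (+ length D) ⟩
    + 0                                          ∎

module Stars where

  open Counting
  open FinEquality
  open NetDegrees
  open import Data.Nat as ℕ using (ℕ; zero; suc; _≤_)
  open import Data.Nat.Properties using (suc-injective)
  open import Data.Fin using (Fin)
  open import Data.Integer using (+_; _+_; _-_; -_)
  open import Data.Integer.Tactic.RingSolver using (solve-∀)
  open import Data.List using (List; []; _∷_; length; map; replicate)
  open import Data.List.Relation.Unary.All using (All; []; _∷_)
  open import Data.List.Relation.Unary.Any using (here; there)
  open import Data.List.Membership.Propositional using (_∈_)
  open import Data.List.Relation.Binary.Pointwise using (Pointwise; []; _∷_)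
  open import Data.Product using (∃; _×_; _,_)
  open import Data.Sum using (_⊎_; inj₁; inj₂)
  open import Relation.Binary.PropositionalEquality
  open ≡-Reasoning

  star : ∀ {n} → Fin n → ℕ → List (Fin n) → MGraph n
  star c zero xs = map (λ x → (x , c)) xs
  star c (suc p) [] = []
  star c (suc p) (x ∷ xs) = (c , x) ∷ star c p xs

  Joins : ∀ {n} → Fin n → Fin n → Edge n → Set
  Joins c x e = e ≡ (c , x) ⊎ e ≡ (x , c)

  star-orients : ∀ {n} (c : Fin n) p {xs G} → Pointwise (Joins c) xs G → Orientation (star c p xs) G
  star-orients c zero [] = []
  star-orients c zero (inj₁ refl ∷ js) = flipDir ∷ star-orients c zero js
  star-orients c zero (inj₂ refl ∷ js) = keepDir ∷ star-orients c zero js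
  star-orients c (suc p) [] = []
  star-orients c (suc p) (inj₁ refl ∷ js) = keepDir ∷ star-orients c p js
  star-orients c (suc p) (inj₂ refl ∷ js) = flipDir ∷ star-orients c p js

  private
    arcNet-out : ∀ {n} {c x : Fin n} → x ≢ c → arcNet c (c , x) ≡ + 1
    arcNet-out {c = c} x≢c rewrite ==-refl c | ≢⇒==-false x≢c = refl

    arcNet-in : ∀ {n} {c x : Fin n} → x ≢ c → arcNet c (x , c) ≡ - + 1
    arcNet-in {c = c} x≢c rewrite ==-refl c | ≢⇒==-false x≢c = refl

    arcNet-away : ∀ {n} {z x y : Fin n} → x ≢ z → y ≢ z → arcNet z (x , y) ≡ + 0
    arcNet-away x≢z y≢z rewrite ≢⇒==-false x≢z | ≢⇒==-false y≢z = refl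

  netDegree-star-centre : ∀ {n} (c : Fin n) p q xs → p ℕ.+ q ≡ length xs → All (_≢ c) xs →
    netDegree (star c p xs) c ≡ + p - + q
  netDegree-star-centre c zero zero [] refl [] = refl
  netDegree-star-centre c zero (suc q) (x ∷ xs) eq (x≢c ∷ xs≢c) = begin
    netDegree ((x , c) ∷ star c zero xs) c          ≡⟨ netDegree-∷ (x , c) (star c zero xs) c ⟩
    arcNet c (x , c) + netDegree (star c zero xs) c ≡⟨ cong₂ _+_ (arcNet-in x≢c) (netDegree-star-centre c zero q xs (suc-injective eq) xs≢c) ⟩
    - + 1 + (+ 0 - + q)                             ≡⟨ shift (+ q) ⟩
    + 0 - + suc q                                   ∎
    where
    shift : ∀ q → - + 1 + (+ 0 - q) ≡ + 0 - (+ 1 + q)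
    shift = solve-∀
  netDegree-star-centre c (suc p) q (x ∷ xs) eq (x≢c ∷ xs≢c) = begin
    netDegree ((c , x) ∷ star c p xs) c           ≡⟨ netDegree-∷ (c , x) (star c p xs) c ⟩
    arcNet c (c , x) + netDegree (star c p xs) c  ≡⟨ cong₂ _+_ (arcNet-out x≢c) (netDegree-star-centre c p q xs (suc-injective eq) xs≢c) ⟩
    + 1 + (+ p - + q)                             ≡⟨ shift (+ p) (+ q) ⟩
    + suc p - + q                                 ∎
    where
    shift : ∀ p q → + 1 + (p - q) ≡ (+ 1 + p) - q
    shift = solve-∀

  netDegree-star-away : ∀ {n} {c z : Fin n} → c ≢ z → ∀ p {xs} → All (_≢ z) xs → netDegree (star c p xs) z ≡ + 0
  netDegree-star-away c≢z zero [] = refl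
  netDegree-star-away {c = c} {z} c≢z zero {x ∷ xs} (x≢z ∷ xs≢z) =
    trans (netDegree-∷ (x , c) (star c zero xs) z) (cong₂ _+_ (arcNet-away x≢z c≢z) (netDegree-star-away c≢z zero xs≢z))
  netDegree-star-away c≢z (suc p) [] = refl
  netDegree-star-away {c = c} {z} c≢z (suc p) {x ∷ xs} (x≢z ∷ xs≢z) =
    trans (netDegree-∷ (c , x) (star c p xs) z) (cong₂ _+_ (arcNet-away c≢z x≢z) (netDegree-star-away c≢z p xs≢z))

  netDegree-star-end : ∀ {n} {c t : Fin n} → t ≢ c → ∀ p q m → p ℕ.+ q ≡ m → netDegree (star c p (replicate m t)) t ≡ + q - + p
  netDegree-star-end t≢c zero zero zero refl = refl
  netDegree-star-end {c = c} {t} t≢c zero (suc q) (suc m) eq = begin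
    netDegree ((t , c) ∷ star c zero (replicate m t)) t          ≡⟨ netDegree-∷ (t , c) (star c zero (replicate m t)) t ⟩
    arcNet t (t , c) + netDegree (star c zero (replicate m t)) t ≡⟨ cong₂ _+_ (arcNet-out (≢-sym t≢c)) (netDegree-star-end t≢c zero q m (suc-injective eq)) ⟩
    + 1 + (+ q - + 0)                                            ≡⟨ shift (+ q) ⟩
    + suc q - + 0                                                ∎
    where
    shift : ∀ q → + 1 + (q - + 0) ≡ (+ 1 + q) - + 0
    shift = solve-∀
  netDegree-star-end {c = c} {t} t≢c (suc p) q (suc m) eq = begin
    netDegree ((c , t) ∷ star c p (replicate m t)) t          ≡⟨ netDegree-∷ (c , t) (star c p (replicate m t)) t ⟩
    arcNet t (c , t) + netDegree (star c p (replicate m t)) t ≡⟨ cong₂ _+_ (arcNet-in (≢-sym t≢c)) (netDegree-star-end t≢c p q m (suc-injective eq)) ⟩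
    - + 1 + (+ q - + p)                                       ≡⟨ shift (+ q) (+ p) ⟩
    + q - + suc p                                             ∎
    where
    shift : ∀ q p → - + 1 + (q - p) ≡ q - (+ 1 + p)
    shift = solve-∀

  star-has-out : ∀ {n} (c : Fin n) p q xs → p ℕ.+ q ≡ length xs → 1 ≤ p → ∃ λ x → x ∈ xs × (c , x) ∈ star c p xs
  star-has-out c (suc p) q (x ∷ xs) _ _ = x , here refl , here refl

  star-has-in : ∀ {n} (c : Fin n) p q xs → p ℕ.+ q ≡ length xs → 1 ≤ q → ∃ λ x → x ∈ xs × (x , c) ∈ star c p xs
  star-has-in c zero (suc q) (x ∷ xs) _ _ = x , here refl , here refl
  star-has-in c (suc p) q (x ∷ xs) eq 1≤q with star-has-in c p q xs (suc-injective eq) 1≤q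
  ... | y , y∈xs , yc∈star = y , there y∈xs , there yc∈star

module Neighbourhood {n : ℕ} (u v : Fin n) (u≢v : u ≢ v) where

  open Counting
  open FinEquality
  open Orientations using (crosses)
  open Stars using (Joins)
  open import Data.Nat using (ℕ; _+_; _≤_)
  open import Data.Nat.Properties using (+-identityʳ; ≤-trans)
  open import Data.Fin using (Fin; _≟_)
  open import Data.Bool using (Bool; true; false; not; _∧_; _∨_)
  open import Data.Bool.Properties using (∨-zeroʳ; ∨-identityʳ)
  open import Data.Empty using (⊥-elim)
  open import Data.List using (List; []; _∷_; _++_; length; map; replicate)
  open import Data.List.Relation.Binary.Pointwise using (Pointwise; []; _∷_)
  open import Data.List.Relation.Unary.All as All using (All; []; _∷_)
  open import Data.List.Membership.Propositional using (_∈_)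
  open import Data.List.Relation.Unary.Any using (here; there)
  open import Data.List.Relation.Binary.Permutation.Propositional as ↭ using (_↭_; ↭-sym)
  open import Data.List.Relation.Binary.Permutation.Propositional.Properties using (shift; ++⁺ˡ; ∈-resp-↭)
  open import Data.Product using (Σ; ∃; _×_; _,_; proj₁; proj₂)
  open import Data.Sum using (_⊎_; inj₁; inj₂)
  open import Function using (_∘_)
  open import Relation.Nullary using (yes; no)
  open import Relation.Binary.PropositionalEquality

  v≢u : v ≢ u
  v≢u = ≢-sym u≢v

  Outside : Set
  Outside = Σ (Fin n) λ x → x ≢ u × x ≢ v

  -- An edge between a centre c ∈ {u, v} and an outside vertex, listed as leaving c iff the flag is true.
  Spoke : Set
  Spoke = Outside × Bool

  tip : Spoke → Fin n
  tip ((x , _) , _) = x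

  uvEdge : Bool → Edge n
  uvEdge true = (u , v)
  uvEdge false = (v , u)

  spokeEdge : Fin n → Spoke → Edge n
  spokeEdge c ((x , _) , true) = (c , x)
  spokeEdge c ((x , _) , false) = (x , c)

  layout : List Bool → List Spoke → List Spoke → MGraph n → MGraph n
  layout ds us vs A = map uvEdge ds ++ map (spokeEdge u) us ++ map (spokeEdge v) vs ++ A

  record Arrangement (G : MGraph n) : Set where
    field
      uvEdges : List Bool
      uSpokes vSpokes : List Spoke
      arranged : G ↭ layout uvEdges uSpokes vSpokes (avoiding u v G)

  touches : Edge n → Bool
  touches (x , y) = x == u ∨ x == v ∨ y == u ∨ y == v

  touches-true : ∀ {x y} → x ≡ u ⊎ x ≡ v ⊎ y ≡ u ⊎ y ≡ v → touches (x , y) ≡ true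
  touches-true (inj₁ refl) rewrite ==-refl u = refl
  touches-true {x} (inj₂ (inj₁ refl)) rewrite ==-refl v = ∨-zeroʳ (x == u)
  touches-true {x} (inj₂ (inj₂ (inj₁ refl))) rewrite ==-refl u = trans (cong (x == u ∨_) (∨-zeroʳ (x == v))) (∨-zeroʳ (x == u))
  touches-true {x} {y} (inj₂ (inj₂ (inj₂ refl))) rewrite ==-refl v =
    trans (cong (λ b → x == u ∨ x == v ∨ b) (∨-zeroʳ (y == u))) (trans (cong (x == u ∨_) (∨-zeroʳ (x == v))) (∨-zeroʳ (x == u)))

  touches-false : ∀ {x y} → x ≢ u → x ≢ v → y ≢ u → y ≢ v → touches (x , y) ≡ false
  touches-false x≢u x≢v y≢u y≢v rewrite ≢⇒==-false x≢u | ≢⇒==-false x≢v | ≢⇒==-false y≢u | ≢⇒==-false y≢v = refl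

  avoiding-∷-touching : ∀ {e} G → touches e ≡ true → avoiding u v (e ∷ G) ≡ avoiding u v G
  avoiding-∷-touching G t rewrite t = refl

  avoiding-∷-untouched : ∀ {e} G → touches e ≡ false → avoiding u v (e ∷ G) ≡ e ∷ avoiding u v G
  avoiding-∷-untouched G t rewrite t = refl

  touches-uvEdge : ∀ d → touches (uvEdge d) ≡ true
  touches-uvEdge true = touches-true {y = v} (inj₁ refl)
  touches-uvEdge false = touches-true {y = u} (inj₂ (inj₁ refl))

  touches-uSpoke : ∀ w → touches (spokeEdge u w) ≡ true
  touches-uSpoke ((x , _) , true) = touches-true {y = x} (inj₁ refl)
  touches-uSpoke ((x , _) , false) = touches-true {x} (inj₂ (inj₂ (inj₁ refl)))

  touches-vSpoke : ∀ w → touches (spokeEdge v w) ≡ true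
  touches-vSpoke ((x , _) , true) = touches-true {y = x} (inj₂ (inj₁ refl))
  touches-vSpoke ((x , _) , false) = touches-true {x} (inj₂ (inj₂ (inj₂ refl)))

  private
    add-uvEdge : ∀ {G} d → Arrangement G → Arrangement (uvEdge d ∷ G)
    add-uvEdge {G} d arr = record
      { uvEdges = d ∷ uvEdges ; uSpokes = uSpokes ; vSpokes = vSpokes ; arranged = arranged′ }
      where
      open Arrangement arr
      arranged′ : uvEdge d ∷ G ↭ layout (d ∷ uvEdges) uSpokes vSpokes (avoiding u v (uvEdge d ∷ G))
      arranged′ = subst (λ A → uvEdge d ∷ G ↭ layout (d ∷ uvEdges) uSpokes vSpokes A) (sym (avoiding-∷-touching G (touches-uvEdge d)))
                    (↭.prep _ arranged)

    add-uSpoke : ∀ {G} w → Arrangement G → Arrangement (spokeEdge u w ∷ G)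
    add-uSpoke {G} w arr = record
      { uvEdges = uvEdges ; uSpokes = w ∷ uSpokes ; vSpokes = vSpokes ; arranged = arranged′ }
      where
      open Arrangement arr
      arranged′ : spokeEdge u w ∷ G ↭ layout uvEdges (w ∷ uSpokes) vSpokes (avoiding u v (spokeEdge u w ∷ G))
      arranged′ = subst (λ A → spokeEdge u w ∷ G ↭ layout uvEdges (w ∷ uSpokes) vSpokes A) (sym (avoiding-∷-touching G (touches-uSpoke w)))
        (↭.trans (↭.prep _ arranged) (↭-sym (shift _ (map uvEdge uvEdges) _)))

    add-vSpoke : ∀ {G} w → Arrangement G → Arrangement (spokeEdge v w ∷ G)
    add-vSpoke {G} w arr = record
      { uvEdges = uvEdges ; uSpokes = uSpokes ; vSpokes = w ∷ vSpokes ; arranged = arranged′ }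
      where
      open Arrangement arr
      arranged′ : spokeEdge v w ∷ G ↭ layout uvEdges uSpokes (w ∷ vSpokes) (avoiding u v (spokeEdge v w ∷ G))
      arranged′ = subst (λ A → spokeEdge v w ∷ G ↭ layout uvEdges uSpokes (w ∷ vSpokes) A) (sym (avoiding-∷-touching G (touches-vSpoke w)))
        (↭.trans (↭.prep _ arranged) (↭.trans (↭-sym (shift _ (map uvEdge uvEdges) _))
          (++⁺ˡ (map uvEdge uvEdges) (↭-sym (shift _ (map (spokeEdge u) uSpokes) _)))))

    add-untouched : ∀ {G} e → touches e ≡ false → Arrangement G → Arrangement (e ∷ G)
    add-untouched {G} e untouched arr = record
      { uvEdges = uvEdges ; uSpokes = uSpokes ; vSpokes = vSpokes ; arranged = arranged′ }
      where
      open Arrangement arr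
      arranged′ : e ∷ G ↭ layout uvEdges uSpokes vSpokes (avoiding u v (e ∷ G))
      arranged′ = subst (λ A → e ∷ G ↭ layout uvEdges uSpokes vSpokes A) (sym (avoiding-∷-untouched G untouched))
        (↭.trans (↭.prep _ arranged) (↭.trans (↭-sym (shift _ (map uvEdge uvEdges) _))
          (++⁺ˡ (map uvEdge uvEdges) (↭.trans (↭-sym (shift _ (map (spokeEdge u) uSpokes) _))
            (++⁺ˡ (map (spokeEdge u) uSpokes) (↭-sym (shift _ (map (spokeEdge v) vSpokes) _)))))))

  arrange : (G : MGraph n) → Loopless G → Arrangement G
  arrange [] [] = record { uvEdges = [] ; uSpokes = [] ; vSpokes = [] ; arranged = ↭.refl }
  arrange ((x , y) ∷ G) (x≢y ∷ loopless) with arrange G loopless | x ≟ u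
  ... | arr | yes refl with y ≟ v
  ...   | yes refl = add-uvEdge true arr
  ...   | no y≢v with y ≟ u
  ...     | yes refl = ⊥-elim (x≢y refl)
  ...     | no y≢u = add-uSpoke ((y , y≢u , y≢v) , true) arr
  arrange ((x , y) ∷ G) (x≢y ∷ _) | arr | no x≢u with x ≟ v
  ... | yes refl with y ≟ u
  ...   | yes refl = add-uvEdge false arr
  ...   | no y≢u with y ≟ v
  ...     | yes refl = ⊥-elim (x≢y refl)
  ...     | no y≢v = add-vSpoke ((y , y≢u , y≢v) , true) arr
  arrange ((x , y) ∷ G) (x≢y ∷ _) | arr | no x≢u | no x≢v with y ≟ u
  ... | yes refl = add-uSpoke ((x , x≢u , x≢v) , false) arr
  ... | no y≢u with y ≟ v
  ...   | yes refl = add-vSpoke ((x , x≢u , x≢v) , false) arr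
  ...   | no y≢v = add-untouched (x , y) (touches-false x≢u x≢v y≢u y≢v) arr

  count-layout : ∀ (c : Edge n → Bool) ds us vs A → count c (layout ds us vs A) ≡
    count c (map uvEdge ds) + (count c (map (spokeEdge u) us) + (count c (map (spokeEdge v) vs) + count c A))
  count-layout c ds us vs A =
    trans (count-++ c (map uvEdge ds) _) (cong (count c (map uvEdge ds) +_)
      (trans (count-++ c (map (spokeEdge u) us) _) (cong (count c (map (spokeEdge u) us) +_)
        (count-++ c (map (spokeEdge v) vs) A))))

  Untouched : Edge n → Set
  Untouched (x , y) = x ≢ u × x ≢ v × y ≢ u × y ≢ v

  count-avoiding : ∀ (c : Edge n → Bool) → (∀ e → Untouched e → c e ≡ false) → ∀ G → count c (avoiding u v G) ≡ 0
  count-avoiding c c≡false G = count-none c (All.map off (keep-All _ G))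
    where
    off : ∀ {e} → not (touches e) ≡ true → c e ≡ false
    off {x , y} untouched with x == u in xu | x == v in xv | y == u in yu | y == v in yv | untouched
    ... | false | false | false | false | _ = c≡false (x , y) (==-false⇒≢ xu , ==-false⇒≢ xv , ==-false⇒≢ yu , ==-false⇒≢ yv)

  joinsᵇ : Fin n → Fin n → Edge n → Bool
  joinsᵇ y z (a , b) = (a == y ∧ b == z) ∨ (b == y ∧ a == z)

  joinsᵇ-forward : ∀ y z → joinsᵇ y z (y , z) ≡ true
  joinsᵇ-forward y z rewrite ==-refl y | ==-refl z = refl

  joinsᵇ-backward : ∀ y z → joinsᵇ y z (z , y) ≡ true
  joinsᵇ-backward y z rewrite ==-refl y | ==-refl z = ∨-zeroʳ _

  adjacent⇒1≤count-joinsᵇ : ∀ {G y z} → Adjacent G y z → 1 ≤ count (joinsᵇ y z) G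
  adjacent⇒1≤count-joinsᵇ {y = y} {z} (inj₁ yz∈G) = ∈⇒1≤count _ yz∈G (joinsᵇ-forward y z)
  adjacent⇒1≤count-joinsᵇ {y = y} {z} (inj₂ zy∈G) = ∈⇒1≤count _ zy∈G (joinsᵇ-backward y z)

  joinsᵇ-vSpoke : ∀ y w → joinsᵇ v y (spokeEdge v w) ≡ (tip w == y)
  joinsᵇ-vSpoke y ((x , _ , x≢v) , true) rewrite ==-refl v | ≢⇒==-false x≢v = ∨-identityʳ (x == y)
  joinsᵇ-vSpoke y ((x , _ , x≢v) , false) rewrite ==-refl v | ≢⇒==-false x≢v = refl

  uvEdges-join : ∀ ds → Pointwise (Joins u) (replicate (length ds) v) (map uvEdge ds)
  uvEdges-join [] = []
  uvEdges-join (true ∷ ds) = inj₁ refl ∷ uvEdges-join ds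
  uvEdges-join (false ∷ ds) = inj₂ refl ∷ uvEdges-join ds

  spokes-join : ∀ c ws → Pointwise (Joins c) (map tip ws) (map (spokeEdge c) ws)
  spokes-join c [] = []
  spokes-join c ((_ , true) ∷ ws) = inj₁ refl ∷ spokes-join c ws
  spokes-join c ((_ , false) ∷ ws) = inj₂ refl ∷ spokes-join c ws

  tips≢u : ∀ ws → All (_≢ u) (map tip ws)
  tips≢u [] = []
  tips≢u (((_ , x≢u , _) , _) ∷ ws) = x≢u ∷ tips≢u ws

  tips≢v : ∀ ws → All (_≢ v) (map tip ws)
  tips≢v [] = []
  tips≢v (((_ , _ , x≢v) , _) ∷ ws) = x≢v ∷ tips≢v ws

  spoke-towards : ∀ c w → Orients (tip w , c) (spokeEdge c w)
  spoke-towards c (_ , true) = flipDir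
  spoke-towards c (_ , false) = keepDir

  spoke-away : ∀ c w → Orients (c , tip w) (spokeEdge c w)
  spoke-away c (_ , true) = keepDir
  spoke-away c (_ , false) = flipDir

  module Arranged {G : MGraph n} (arr : Arrangement G) where
    open Arrangement arr

    count-arranged : ∀ (c : Edge n → Bool) → (∀ e → Untouched e → c e ≡ false) → count c G ≡
      count (c ∘ uvEdge) uvEdges + (count (c ∘ spokeEdge u) uSpokes + count (c ∘ spokeEdge v) vSpokes)
    count-arranged c c-untouched = begin
      count c G                                                   ≡⟨ count-↭ c arranged ⟩
      count c (layout uvEdges uSpokes vSpokes (avoiding u v G))   ≡⟨ count-layout c uvEdges uSpokes vSpokes _ ⟩
      count c UV + (count c US + (count c VS + count c (avoiding u v G)))
        ≡⟨ cong (λ k → count c UV + (count c US + (count c VS + k))) (count-avoiding c c-untouched G) ⟩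
      count c UV + (count c US + (count c VS + 0))                ≡⟨ cong (λ k → count c UV + (count c US + k)) (+-identityʳ _) ⟩
      count c UV + (count c US + count c VS)
        ≡⟨ cong₂ _+_ (count-map c uvEdge uvEdges) (cong₂ _+_ (count-map c (spokeEdge u) uSpokes) (count-map c (spokeEdge v) vSpokes)) ⟩
      count (c ∘ uvEdge) uvEdges + (count (c ∘ spokeEdge u) uSpokes + count (c ∘ spokeEdge v) vSpokes) ∎
      where
      open ≡-Reasoning
      UV US VS : MGraph n
      UV = map uvEdge uvEdges
      US = map (spokeEdge u) uSpokes
      VS = map (spokeEdge v) vSpokes

    degree-u : count (crosses (_== u)) G ≡ length uvEdges + length uSpokes
    degree-u = begin
      count c G                                        ≡⟨ count-arranged c off ⟩
      count (c ∘ uvEdge) uvEdges + (count (c ∘ spokeEdge u) uSpokes + count (c ∘ spokeEdge v) vSpokes)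
        ≡⟨ cong₂ _+_ (count-≡true _ on-uv uvEdges) (cong₂ _+_ (count-≡true _ on-u uSpokes) (count-≡false _ on-v vSpokes)) ⟩
      length uvEdges + (length uSpokes + 0)            ≡⟨ cong (length uvEdges +_) (+-identityʳ _) ⟩
      length uvEdges + length uSpokes                  ∎
      where
      open ≡-Reasoning
      c : Edge n → Bool
      c = crosses (_== u)
      on-uv : ∀ d → c (uvEdge d) ≡ true
      on-uv true rewrite ==-refl u | ≢⇒==-false v≢u = refl
      on-uv false rewrite ==-refl u | ≢⇒==-false v≢u = refl
      on-u : ∀ w → c (spokeEdge u w) ≡ true
      on-u ((x , x≢u , _) , true) rewrite ==-refl u | ≢⇒==-false x≢u = refl
      on-u ((x , x≢u , _) , false) rewrite ==-refl u | ≢⇒==-false x≢u = refl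
      on-v : ∀ w → c (spokeEdge v w) ≡ false
      on-v ((x , x≢u , _) , true) rewrite ≢⇒==-false v≢u | ≢⇒==-false x≢u = refl
      on-v ((x , x≢u , _) , false) rewrite ≢⇒==-false v≢u | ≢⇒==-false x≢u = refl
      off : ∀ e → Untouched e → c e ≡ false
      off (x , y) (x≢u , _ , y≢u , _) rewrite ≢⇒==-false x≢u | ≢⇒==-false y≢u = refl

    cut-uv : count (crosses (λ x → x == u ∨ x == v)) G ≡ length uSpokes + length vSpokes
    cut-uv = begin
      count c G                                        ≡⟨ count-arranged c off ⟩
      count (c ∘ uvEdge) uvEdges + (count (c ∘ spokeEdge u) uSpokes + count (c ∘ spokeEdge v) vSpokes)
        ≡⟨ cong₂ _+_ (count-≡false _ on-uv uvEdges) (cong₂ _+_ (count-≡true _ on-u uSpokes) (count-≡true _ on-v vSpokes)) ⟩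
      length uSpokes + length vSpokes                  ∎
      where
      open ≡-Reasoning
      c : Edge n → Bool
      c = crosses (λ x → x == u ∨ x == v)
      on-uv : ∀ d → c (uvEdge d) ≡ false
      on-uv true rewrite ==-refl u | ==-refl v | ≢⇒==-false v≢u = refl
      on-uv false rewrite ==-refl u | ==-refl v | ≢⇒==-false v≢u = refl
      on-u : ∀ w → c (spokeEdge u w) ≡ true
      on-u ((x , x≢u , x≢v) , true) rewrite ==-refl u | ≢⇒==-false x≢u | ≢⇒==-false x≢v = refl
      on-u ((x , x≢u , x≢v) , false) rewrite ==-refl u | ≢⇒==-false x≢u | ≢⇒==-false x≢v = refl
      on-v : ∀ w → c (spokeEdge v w) ≡ true
      on-v ((x , x≢u , x≢v) , true) rewrite ==-refl v | ≢⇒==-false v≢u | ≢⇒==-false x≢u | ≢⇒==-false x≢v = refl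
      on-v ((x , x≢u , x≢v) , false) rewrite ==-refl v | ≢⇒==-false v≢u | ≢⇒==-false x≢u | ≢⇒==-false x≢v = refl
      off : ∀ e → Untouched e → c e ≡ false
      off (x , y) (x≢u , x≢v , y≢u , y≢v) rewrite ≢⇒==-false x≢u | ≢⇒==-false x≢v | ≢⇒==-false y≢u | ≢⇒==-false y≢v = refl

    eOut≡vSpokes : eOut G u v ≡ length vSpokes
    eOut≡vSpokes = begin
      count c G                                        ≡⟨ count-arranged c off ⟩
      count (c ∘ uvEdge) uvEdges + (count (c ∘ spokeEdge u) uSpokes + count (c ∘ spokeEdge v) vSpokes)
        ≡⟨ cong₂ _+_ (count-≡false _ on-uv uvEdges) (cong₂ _+_ (count-≡false _ on-u uSpokes) (count-≡true _ on-v vSpokes)) ⟩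
      length vSpokes                                   ∎
      where
      open ≡-Reasoning
      c : Edge n → Bool
      c e = (proj₁ e == v ∧ not (proj₂ e == u) ∧ not (proj₂ e == v)) ∨ (proj₂ e == v ∧ not (proj₁ e == u) ∧ not (proj₁ e == v))
      on-uv : ∀ d → c (uvEdge d) ≡ false
      on-uv true rewrite ==-refl u | ==-refl v | ≢⇒==-false u≢v = refl
      on-uv false rewrite ==-refl u | ==-refl v | ≢⇒==-false u≢v = refl
      on-u : ∀ w → c (spokeEdge u w) ≡ false
      on-u ((x , _ , x≢v) , true) rewrite ≢⇒==-false u≢v | ≢⇒==-false x≢v = refl
      on-u ((x , _ , x≢v) , false) rewrite ≢⇒==-false u≢v | ≢⇒==-false x≢v = refl
      on-v : ∀ w → c (spokeEdge v w) ≡ true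
      on-v ((x , x≢u , x≢v) , true) rewrite ==-refl v | ≢⇒==-false x≢u | ≢⇒==-false x≢v = refl
      on-v ((x , x≢u , x≢v) , false) rewrite ==-refl v | ≢⇒==-false x≢u | ≢⇒==-false x≢v = refl
      off : ∀ e → Untouched e → c e ≡ false
      off (x , y) (_ , x≢v , _ , y≢v) rewrite ≢⇒==-false x≢v | ≢⇒==-false y≢v = refl

    uvEdges-nonempty : Adjacent G u v → 1 ≤ length uvEdges
    uvEdges-nonempty adj = ≤-trans (subst (1 ≤_) only-uv (adjacent⇒1≤count-joinsᵇ adj)) (count≤length _ uvEdges)
      where
      c : Edge n → Bool
      c = joinsᵇ u v
      on-u : ∀ w → c (spokeEdge u w) ≡ false
      on-u ((x , x≢u , x≢v) , true) rewrite ==-refl u | ≢⇒==-false x≢u | ≢⇒==-false x≢v = refl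
      on-u ((x , x≢u , x≢v) , false) rewrite ==-refl u | ≢⇒==-false x≢u | ≢⇒==-false x≢v = refl
      on-v : ∀ w → c (spokeEdge v w) ≡ false
      on-v ((x , x≢u , _) , true) rewrite ≢⇒==-false v≢u | ≢⇒==-false x≢u = refl
      on-v ((x , x≢u , _) , false) rewrite ≢⇒==-false v≢u | ≢⇒==-false x≢u = refl
      off : ∀ e → Untouched e → c e ≡ false
      off (x , y) (x≢u , _ , y≢u , _) rewrite ≢⇒==-false x≢u | ≢⇒==-false y≢u = refl
      only-uv : count c G ≡ count (c ∘ uvEdge) uvEdges
      only-uv = trans (count-arranged c off)
        (trans (cong (count (c ∘ uvEdge) uvEdges +_) (cong₂ _+_ (count-≡false _ on-u uSpokes) (count-≡false _ on-v vSpokes)))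
               (+-identityʳ _))

    vSpoke-to : ∀ {y} → y ≢ u → y ≢ v → Adjacent G v y → ∃ λ w → w ∈ vSpokes × tip w ≡ y
    vSpoke-to {y} y≢u y≢v adj with 1≤count⇒∃ _ vSpokes (subst (1 ≤_) only-v (adjacent⇒1≤count-joinsᵇ adj))
      where
      c : Edge n → Bool
      c = joinsᵇ v y
      on-uv : ∀ d → c (uvEdge d) ≡ false
      on-uv true rewrite ==-refl v | ≢⇒==-false u≢v | ≢⇒==-false (≢-sym y≢u) = refl
      on-uv false rewrite ==-refl v | ≢⇒==-false u≢v | ≢⇒==-false (≢-sym y≢u) = refl
      on-u : ∀ w → c (spokeEdge u w) ≡ false
      on-u ((x , _ , x≢v) , true) rewrite ≢⇒==-false u≢v | ≢⇒==-false x≢v = refl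
      on-u ((x , _ , x≢v) , false) rewrite ≢⇒==-false u≢v | ≢⇒==-false x≢v = refl
      off : ∀ e → Untouched e → c e ≡ false
      off (x , x′) (_ , x≢v , _ , x′≢v) rewrite ≢⇒==-false x≢v | ≢⇒==-false x′≢v = refl
      only-v : count c G ≡ count (c ∘ spokeEdge v) vSpokes
      only-v = trans (count-arranged c off) (cong₂ _+_ (count-≡false _ on-uv uvEdges) (cong₂ _+_ (count-≡false _ on-u uSpokes) refl))
    ... | w , w∈ , w-joins = w , w∈ , ==-true⇒≡ (trans (sym (joinsᵇ-vSpoke y w)) w-joins)

    record TwoSpokes (a b : Fin n) : Set where
      field
        spoke-a spoke-b : Spoke
        otherSpokes : List Spoke
        vSpokes↭ : vSpokes ↭ spoke-a ∷ spoke-b ∷ otherSpokes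
        tip-a : tip spoke-a ≡ a
        tip-b : tip spoke-b ≡ b

    twoSpokes : ∀ {a b} → a ≢ u → a ≢ v → b ≢ u → b ≢ v → a ≢ b → Adjacent G v a → Adjacent G v b → TwoSpokes a b
    twoSpokes a≢u a≢v b≢u b≢v a≢b adj-a adj-b
      with vSpoke-to a≢u a≢v adj-a | vSpoke-to b≢u b≢v adj-b
    ... | wa , wa∈ , tip-a | wb , wb∈ , tip-b with ∈⇒↭∷ wa∈
    ...   | ys , vs↭ with ∈-resp-↭ vs↭ wb∈
    ...     | here wb≡wa = ⊥-elim (a≢b (trans (sym tip-a) (trans (cong tip (sym wb≡wa)) tip-b)))
    ...     | there wb∈ys with ∈⇒↭∷ wb∈ys
    ...       | zs , ys↭ = record { spoke-a = wa ; spoke-b = wb ; otherSpokes = zs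
                                   ; vSpokes↭ = ↭.trans vs↭ (↭.prep wa ys↭) ; tip-a = tip-a ; tip-b = tip-b }

module Lift {n k : ℕ} {G : MGraph n} {u v a b : Fin n} (u≢v : u ≢ v)
            (a≢u : a ≢ u) (a≢v : a ≢ v) (b≢u : b ≢ u) (b≢v : b ≢ v)
            {ι : Fin k → Fin n} {G₁ : MGraph k} (G₁-is : IsDeleteAdd G u v a b ι G₁)
            (arr : Neighbourhood.Arrangement u v u≢v G) (two : Neighbourhood.Arranged.TwoSpokes u v u≢v arr a b) where

  open Counting
  open FinEquality
  open Splits
  open Residues
  open VertexSums using (sumV≡sum; sum-−; sum∘ι≡sum-at-u-at-v)
  open Orientations
  open NetDegrees
  open Stars
  open import Data.Nat as ℕ using (ℕ; _≤_; _≥_)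
  import Data.Nat.Properties as ℕ
  open import Data.Fin using (Fin; _≟_)
  open import Data.Integer using (ℤ; +_; _+_; _-_; -_; _%ℕ_)
  open import Data.Integer.Properties using (pos-+)
  import Data.Integer.Divisibility as Unsigned
  open import Data.Integer.Divisibility.Signed using (_∣_; ∣ᵤ⇒∣; ∣⇒∣ᵤ; ∣m⇒∣-m; ∣m∣n⇒∣m-n)
  open import Algebra.Properties.CommutativeMonoid.Sum Data.Integer.Properties.+-0-commutativeMonoid using (sum)
  open import Data.Integer.Tactic.RingSolver using (solve-∀)
  open import Data.Bool using (true; false; _∨_)
  open import Data.List using ([]; _∷_; _++_; length; map; replicate)
  open import Data.List.Properties using (++-assoc; length-replicate; length-map)
  import Data.List.Relation.Unary.All as All
  open import Data.List.Relation.Unary.All.Properties using (replicate⁺)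
  open import Data.List.Relation.Unary.Any using (here; there)
  open import Data.List.Membership.Propositional using (_∈_)
  open import Data.List.Membership.Propositional.Properties using (∈-++⁺ˡ; ∈-++⁺ʳ; ∈-map⁺)
  open import Data.List.Relation.Binary.Pointwise using ([]; _∷_)
  open import Data.List.Relation.Binary.Permutation.Propositional as ↭ using (_↭_; ↭-sym; ↭-reflexive)
  open import Data.List.Relation.Binary.Permutation.Propositional.Properties using (++⁺ˡ; ++⁺ʳ; map⁺; shifts; ∈-resp-↭; ↭-length)
  open import Data.Product using (Σ; ∃; _×_; _,_; proj₁; proj₂)
  open import Data.Sum using (_⊎_; inj₁; inj₂)
  open import Relation.Nullary using (yes; no)
  open import Relation.Binary.PropositionalEquality
  open ≡-Reasoning

  open Neighbourhood u v u≢v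
  open Arrangement arr
  open Arranged arr
  open TwoSpokes two
  open IsDeleteAdd G₁-is

  m s r : ℕ
  m = length uvEdges
  s = length uSpokes
  r = length otherSpokes

  admissible : EdgeConnected 4 G → Adjacent G u v → eOut G u v ≥ 3 → Admissible m s r
  admissible ec uv-adj eOut≥3 = uvEdges-nonempty uv-adj , 1≤r , 4≤m+s , 2≤s+r
    where
    vSpokes-length : length vSpokes ≡ 2 ℕ.+ r
    vSpokes-length = ↭-length vSpokes↭
    1≤r : 1 ≤ r
    1≤r = ℕ.≤-pred (ℕ.≤-pred (subst (3 ≤_) (trans eOut≡vSpokes vSpokes-length) eOut≥3))
    4≤m+s : 4 ≤ m ℕ.+ s
    4≤m+s = subst (4 ≤_) degree-u (edgeConnected⇒cut≥ 4 G ec (_== u) u a (==-refl u) (≢⇒==-false a≢u))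
    4≤s+2+r : 4 ≤ s ℕ.+ (2 ℕ.+ r)
    4≤s+2+r = subst (4 ≤_) (trans cut-uv (cong (s ℕ.+_) vSpokes-length))
                (edgeConnected⇒cut≥ 4 G ec (λ x → x == u ∨ x == v) u a u∈S a∉S)
      where
      u∈S : (u == u ∨ u == v) ≡ true
      u∈S rewrite ==-refl u = refl
      a∉S : (a == u ∨ a == v) ≡ false
      a∉S rewrite ≢⇒==-false a≢u | ≢⇒==-false a≢v = refl
    2≤s+r : 2 ≤ s ℕ.+ r
    2≤s+r = ℕ.≤-pred (ℕ.≤-pred (subst (4 ≤_) (trans (ℕ.+-suc s (1 ℕ.+ r)) (cong ℕ.suc (ℕ.+-suc s r))) 4≤s+2+r))

  fixedEdges : MGraph n
  fixedEdges = map uvEdge uvEdges ++ map (spokeEdge u) uSpokes ++ map (spokeEdge v) otherSpokes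

  G↭fixed++rest : G ↭ fixedEdges ++ spokeEdge v spoke-a ∷ spokeEdge v spoke-b ∷ avoiding u v G
  G↭fixed++rest = ↭.trans arranged (↭.trans (++⁺ˡ UV (++⁺ˡ US (↭.trans (++⁺ʳ A (map⁺ (spokeEdge v) vSpokes↭))
                    (shifts (spokeEdge v spoke-a ∷ spokeEdge v spoke-b ∷ []) R))))
                    (↭-reflexive (sym (trans (++-assoc UV (US ++ R) _) (cong (UV ++_) (++-assoc US R _))))))
    where
    UV US R A : MGraph n
    UV = map uvEdge uvEdges
    US = map (spokeEdge u) uSpokes
    R = map (spokeEdge v) otherSpokes
    A = avoiding u v G

  module WithSplit (β : Fin n → ℤ) (σ : BalancedSplit m s r (β u %ℕ 3) (β v %ℕ 3)) where
    open BalancedSplit σ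

    fixedArcs : MGraph n
    fixedArcs = star u pm (replicate m v) ++ star u ps (map tip uSpokes) ++ star v pr (map tip otherSpokes)

    fixedArcs-orients : Orientation fixedArcs fixedEdges
    fixedArcs-orients = orientation-++ (star-orients u pm (uvEdges-join uvEdges))
                          (orientation-++ (star-orients u ps (spokes-join u uSpokes)) (star-orients v pr (spokes-join v otherSpokes)))

    netDegree-fixedArcs : ∀ x → netDegree fixedArcs x ≡
      netDegree (star u pm (replicate m v)) x + (netDegree (star u ps (map tip uSpokes)) x + netDegree (star v pr (map tip otherSpokes)) x)
    netDegree-fixedArcs x = trans (netDegree-++ (star u pm (replicate m v)) _ x)
                              (cong (_+_ (netDegree (star u pm (replicate m v)) x)) (netDegree-++ (star u ps (map tip uSpokes)) _ x))

    u-balanced-ℤ : + 3 ∣ netDegree fixedArcs u - β u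
    u-balanced-ℤ = subst (λ z → + 3 ∣ z - β u) (sym net-u) (balanced⇒∣ (pm ℕ.+ ps) (qm ℕ.+ qs) (β u) u-balanced)
      where
      net-u : netDegree fixedArcs u ≡ + (pm ℕ.+ ps) - + (qm ℕ.+ qs)
      net-u = begin
        netDegree fixedArcs u                  ≡⟨ netDegree-fixedArcs u ⟩
        _                                      ≡⟨ cong₂ _+_ (netDegree-star-centre u pm qm (replicate m v) (trans m-split (sym (length-replicate m))) (replicate⁺ m (≢-sym u≢v)))
                                                    (cong₂ _+_ (netDegree-star-centre u ps qs (map tip uSpokes) (trans s-split (sym (length-map tip uSpokes))) (tips≢u uSpokes))
                                                               (netDegree-star-away (≢-sym u≢v) pr (tips≢u otherSpokes))) ⟩
        (+ pm - + qm) + ((+ ps - + qs) + + 0)  ≡⟨ collect (+ pm) (+ qm) (+ ps) (+ qs) ⟩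
        (+ pm + + ps) - (+ qm + + qs)          ≡⟨ sym (cong₂ _-_ (pos-+ pm ps) (pos-+ qm qs)) ⟩
        + (pm ℕ.+ ps) - + (qm ℕ.+ qs)          ∎
        where
        collect : ∀ a b c d → (a - b) + ((c - d) + + 0) ≡ (a + c) - (b + d)
        collect = solve-∀

    v-balanced-ℤ : + 3 ∣ netDegree fixedArcs v - β v
    v-balanced-ℤ = subst (λ z → + 3 ∣ z - β v) (sym net-v) (balanced⇒∣ (qm ℕ.+ pr) (pm ℕ.+ qr) (β v) v-balanced)
      where
      net-v : netDegree fixedArcs v ≡ + (qm ℕ.+ pr) - + (pm ℕ.+ qr)
      net-v = begin
        netDegree fixedArcs v                  ≡⟨ netDegree-fixedArcs v ⟩
        _                                      ≡⟨ cong₂ _+_ (netDegree-star-end (≢-sym u≢v) pm qm m m-split)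
                                                    (cong₂ _+_ (netDegree-star-away u≢v ps (tips≢v uSpokes))
                                                               (netDegree-star-centre v pr qr (map tip otherSpokes) (trans r-split (sym (length-map tip otherSpokes))) (tips≢v otherSpokes))) ⟩
        (+ qm - + pm) + (+ 0 + (+ pr - + qr))  ≡⟨ collect (+ qm) (+ pm) (+ pr) (+ qr) ⟩
        (+ qm + + pr) - (+ pm + + qr)          ≡⟨ sym (cong₂ _-_ (pos-+ qm pr) (pos-+ pm qr)) ⟩
        + (qm ℕ.+ pr) - + (pm ℕ.+ qr)          ∎
        where
        collect : ∀ a b c d → (a - b) + (+ 0 + (c - d)) ≡ (a + c) - (b + d)
        collect = solve-∀

    β₁ : Fin k → ℤ
    β₁ y = β (ι y) - netDegree fixedArcs (ι y)

    -- The net degrees of fixedArcs sum to 0, so β₁ has the same total as β minus the residual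
    -- demands at u and v, both multiples of 3.
    β₁-zeroSum : ZeroSum3 β → ZeroSum3 β₁
    β₁-zeroSum β-zeroSum = ∣⇒∣ᵤ (subst (+ 3 ∣_) (sym total)
      (∣m∣n⇒∣m-n (∣m∣n⇒∣m-n (subst (+ 3 ∣_) (sumV≡sum β) (∣ᵤ⇒∣ β-zeroSum)) (flip {N u} {β u} u-balanced-ℤ)) (flip {N v} {β v} v-balanced-ℤ)))
      where
      N : Fin n → ℤ
      N = netDegree fixedArcs
      flip : ∀ {z w} → + 3 ∣ z - w → + 3 ∣ w - z
      flip {z} {w} 3∣z-w = subst (+ 3 ∣_) (negate z w) (∣m⇒∣-m 3∣z-w)
        where
        negate : ∀ z w → - (z - w) ≡ w - z
        negate = solve-∀
      total : sumV β₁ ≡ (sum β - (β u - N u)) - (β v - N v)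
      total = begin
        sumV β₁                                              ≡⟨ sumV≡sum β₁ ⟩
        sum β₁                                               ≡⟨ sum-− (λ y → β (ι y)) (λ y → N (ι y)) ⟩
        sum (λ y → β (ι y)) - sum (λ y → N (ι y))            ≡⟨ cong₂ _-_ (sum∘ι≡sum-at-u-at-v u≢v ι-injective ι-avoids ι-onto β)
                                                                         (sum∘ι≡sum-at-u-at-v u≢v ι-injective ι-avoids ι-onto N) ⟩
        (sum β - β u - β v) - (sum N - N u - N v)            ≡⟨ cong (λ z → (sum β - β u - β v) - (z - N u - N v)) (sum-netDegree≡0 fixedArcs) ⟩
        (sum β - β u - β v) - (+ 0 - N u - N v)              ≡⟨ regroup (sum β) (β u) (β v) (N u) (N v) ⟩
        (sum β - (β u - N u)) - (β v - N v)                  ∎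
        where
        regroup : ∀ S bu bv nu nv → (S - bu - bv) - (+ 0 - nu - nv) ≡ (S - (bu - nu)) - (bv - nv)
        regroup = solve-∀

    viaV : ∀ {ab} → Orients ab (a , b) → MGraph n
    viaV keepDir = (a , v) ∷ (v , b) ∷ []
    viaV flipDir = (v , a) ∷ (b , v) ∷ []

    viaV-orients : ∀ {ab} (o : Orients ab (a , b)) → Orientation (viaV o) (spokeEdge v spoke-a ∷ spokeEdge v spoke-b ∷ [])
    viaV-orients keepDir = into-v ∷ out-of-v ∷ []
      where
      into-v : Orients (a , v) (spokeEdge v spoke-a)
      into-v = subst (λ x → Orients (x , v) (spokeEdge v spoke-a)) tip-a (spoke-towards v spoke-a)
      out-of-v : Orients (v , b) (spokeEdge v spoke-b)
      out-of-v = subst (λ x → Orients (v , x) (spokeEdge v spoke-b)) tip-b (spoke-away v spoke-b)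
    viaV-orients flipDir = out-of-v ∷ into-v ∷ []
      where
      out-of-v : Orients (v , a) (spokeEdge v spoke-a)
      out-of-v = subst (λ x → Orients (v , x) (spokeEdge v spoke-a)) tip-a (spoke-away v spoke-a)
      into-v : Orients (b , v) (spokeEdge v spoke-b)
      into-v = subst (λ x → Orients (x , v) (spokeEdge v spoke-b)) tip-b (spoke-towards v spoke-b)

    netDegree-viaV : ∀ {ab} (o : Orients ab (a , b)) D x → netDegree (viaV o ++ D) x ≡ netDegree (ab ∷ D) x
    netDegree-viaV keepDir D x = netDegree-subdivide a v b D x
    netDegree-viaV flipDir D x = trans (netDegree-↭ (↭.swap (v , a) (b , v) (↭.refl {xs = D})) x) (netDegree-subdivide b v a D x)

    viaV-enters : ∀ {ab} (o : Orients ab (a , b)) → (proj₁ ab , v) ∈ viaV o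
    viaV-enters keepDir = here refl
    viaV-enters flipDir = there (here refl)

    viaV-leaves : ∀ {ab} (o : Orients ab (a , b)) → (v , proj₂ ab) ∈ viaV o
    viaV-leaves keepDir = there (here refl)
    viaV-leaves flipDir = here refl

    ends-outside : ∀ {ab} → Orients ab (a , b) → (proj₁ ab ≢ u × proj₁ ab ≢ v) × (proj₂ ab ≢ u × proj₂ ab ≢ v)
    ends-outside keepDir = (a≢u , a≢v) , (b≢u , b≢v)
    ends-outside flipDir = (b≢u , b≢v) , (a≢u , a≢v)

    module Extension {D₁ : MGraph k} {ab : Edge n} {DA : MGraph n} (ab-orients : Orients ab (a , b))
                     (DA-orients : Orientation DA (avoiding u v G)) (ab∷DA↭ : ab ∷ DA ↭ map (relabel ι) D₁) where

      D : MGraph n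
      D = fixedArcs ++ viaV ab-orients ++ DA

      D-orients : Orientation D (fixedEdges ++ spokeEdge v spoke-a ∷ spokeEdge v spoke-b ∷ avoiding u v G)
      D-orients = orientation-++ fixedArcs-orients (orientation-++ (viaV-orients ab-orients) DA-orients)

      netDegree-D : ∀ x → netDegree D x ≡ netDegree fixedArcs x + netDegree (map (relabel ι) D₁) x
      netDegree-D x = trans (netDegree-++ fixedArcs _ x)
        (cong (_+_ (netDegree fixedArcs x)) (trans (netDegree-viaV ab-orients DA x) (netDegree-↭ ab∷DA↭ x)))

      balanced-off-core : ∀ {c} → (∀ y → ι y ≢ c) → + 3 ∣ netDegree fixedArcs c - β c → + 3 Unsigned.∣ netDegree D c - β c
      balanced-off-core {c} ι≢c 3∣ = ∣⇒∣ᵤ (subst (λ z → + 3 ∣ z - β c) (sym net-c) 3∣)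
        where
        net-c : netDegree D c ≡ netDegree fixedArcs c
        net-c = trans (netDegree-D c) (trans (cong (_+_ (netDegree fixedArcs c)) (netDegree-relabel-outside ι≢c D₁))
                                             (Data.Integer.Properties.+-identityʳ _))

      balanced-on-core : ∀ y → netDegree D (ι y) - β (ι y) ≡ netDegree D₁ y - β₁ y
      balanced-on-core y = begin
        netDegree D (ι y) - β (ι y)                                          ≡⟨ cong (_- β (ι y)) (netDegree-D (ι y)) ⟩
        (netDegree fixedArcs (ι y) + netDegree (map (relabel ι) D₁) (ι y)) - β (ι y)
                                                                             ≡⟨ cong (λ z → (netDegree fixedArcs (ι y) + z) - β (ι y))
                                                                                     (netDegree-relabel ι-injective D₁ y) ⟩
        (netDegree fixedArcs (ι y) + netDegree D₁ y) - β (ι y)               ≡⟨ regroup (netDegree fixedArcs (ι y)) (netDegree D₁ y) (β (ι y)) ⟩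
        netDegree D₁ y - β₁ y                                                ∎
        where
        regroup : ∀ f d c → (f + d) - c ≡ d - (c - f)
        regroup = solve-∀

      D-isβ : IsβOrientation D₁ β₁ → IsβOrientation D β
      D-isβ isβ₁ x with x ≟ u
      ... | yes refl = balanced-off-core (λ y → proj₁ (ι-avoids y)) u-balanced-ℤ
      ... | no x≢u with x ≟ v
      ...   | yes refl = balanced-off-core (λ y → proj₂ (ι-avoids y)) v-balanced-ℤ
      ...   | no x≢v with ι-onto x x≢u x≢v
      ...     | y , refl = subst (+ 3 Unsigned.∣_) (sym (balanced-on-core y)) (isβ₁ y)

      private
        via∈D : ∀ {e} → e ∈ viaV ab-orients → e ∈ D
        via∈D e∈ = ∈-++⁺ʳ fixedArcs (∈-++⁺ˡ e∈)

        DA∈D : ∀ {e} → e ∈ DA → e ∈ D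
        DA∈D e∈ = ∈-++⁺ʳ fixedArcs (∈-++⁺ʳ (viaV ab-orients) e∈)

      Core : Fin n → Set
      Core x = ∃ λ y → ι y ≡ x

      outside⇒core : ∀ {x} → x ≢ u → x ≢ v → Core x
      outside⇒core = ι-onto _

      tail-in-core : Core (proj₁ ab)
      tail-in-core = outside⇒core (proj₁ (proj₁ (ends-outside ab-orients))) (proj₂ (proj₁ (ends-outside ab-orients)))

      head-in-core : Core (proj₂ ab)
      head-in-core = outside⇒core (proj₁ (proj₂ (ends-outside ab-orients))) (proj₂ (proj₂ (ends-outside ab-orients)))

      -- The arc ab of the relabelled D₁ is replaced by the path through v.
      lift-arc : ∀ {y z} → (y , z) ∈ D₁ → DPath D (ι y) (ι z)
      lift-arc yz∈D₁ with ∈-resp-↭ (↭-sym ab∷DA↭) (∈-map⁺ (relabel ι) yz∈D₁)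
      ... | here ab≡ = subst₂ (DPath D) (sym (cong proj₁ ab≡)) (sym (cong proj₂ ab≡))
                         (arc (via∈D (viaV-enters ab-orients)) (arc⇒path (via∈D (viaV-leaves ab-orients))))
      ... | there e∈DA = arc⇒path (DA∈D e∈DA)

      lift-path : ∀ {y z} → DPath D₁ y z → DPath D (ι y) (ι z)
      lift-path here = here
      lift-path (arc yw∈D₁ p) = lift-arc yw∈D₁ ++ᵖ lift-path p

      reach-avoiding-u : StronglyConnected D₁ → ∀ {x y} → x ≢ u → y ≢ u → DPath D x y
      reach-avoiding-u sc₁ x≢u y≢u = DPath-attach Core v core-reach
        (proj₂ ab , via∈D (viaV-leaves ab-orients) , head-in-core)
        (proj₁ ab , via∈D (viaV-enters ab-orients) , tail-in-core)
        (core-or-v x≢u) (core-or-v y≢u)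
        where
        core-reach : ∀ {x y} → Core x → Core y → DPath D x y
        core-reach (y , refl) (z , refl) = lift-path (sc₁ y z)
        core-or-v : ∀ {x} → x ≢ u → Core x ⊎ x ≡ v
        core-or-v {x} x≢u with x ≟ v
        ... | yes x≡v = inj₂ x≡v
        ... | no x≢v = inj₁ (outside⇒core x≢u x≢v)

      private
        fixed∈D : ∀ {e} → e ∈ fixedArcs → e ∈ D
        fixed∈D = ∈-++⁺ˡ

        1≤+⇒ : ∀ p q → 1 ≤ p ℕ.+ q → 1 ≤ p ⊎ 1 ≤ q
        1≤+⇒ ℕ.zero q 1≤q = inj₂ 1≤q
        1≤+⇒ (ℕ.suc p) q _ = inj₁ (ℕ.s≤s ℕ.z≤n)

      u-leaves : ∃ λ z → (u , z) ∈ D × z ≢ u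
      u-leaves with 1≤+⇒ pm ps u-has-out
      ... | inj₁ 1≤pm with star-has-out u pm qm (replicate m v) (trans m-split (sym (length-replicate m))) 1≤pm
      ...   | z , z∈ , uz∈ = z , fixed∈D (∈-++⁺ˡ uz∈) , All.lookup (replicate⁺ m (≢-sym u≢v)) z∈
      u-leaves | inj₂ 1≤ps with star-has-out u ps qs (map tip uSpokes) (trans s-split (sym (length-map tip uSpokes))) 1≤ps
      ...   | z , z∈ , uz∈ = z , fixed∈D (∈-++⁺ʳ (star u pm (replicate m v)) (∈-++⁺ˡ uz∈)) , All.lookup (tips≢u uSpokes) z∈

      u-enters : ∃ λ z → (z , u) ∈ D × z ≢ u
      u-enters with 1≤+⇒ qm qs u-has-in
      ... | inj₁ 1≤qm with star-has-in u pm qm (replicate m v) (trans m-split (sym (length-replicate m))) 1≤qm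
      ...   | z , z∈ , zu∈ = z , fixed∈D (∈-++⁺ˡ zu∈) , All.lookup (replicate⁺ m (≢-sym u≢v)) z∈
      u-enters | inj₂ 1≤qs with star-has-in u ps qs (map tip uSpokes) (trans s-split (sym (length-map tip uSpokes))) 1≤qs
      ...   | z , z∈ , zu∈ = z , fixed∈D (∈-++⁺ʳ (star u pm (replicate m v)) (∈-++⁺ˡ zu∈)) , All.lookup (tips≢u uSpokes) z∈

      D-stronglyConnected : StronglyConnected D₁ → StronglyConnected D
      D-stronglyConnected sc₁ x y = DPath-attach (_≢ u) u (reach-avoiding-u sc₁) u-leaves u-enters (avoids-or-u x) (avoids-or-u y)
        where
        avoids-or-u : ∀ x → x ≢ u ⊎ x ≡ u
        avoids-or-u x with x ≟ u
        ... | yes x≡u = inj₂ x≡u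
        ... | no x≢u = inj₁ x≢u

      extension : IsβOrientation D₁ β₁ → StronglyConnected D₁ →
        Σ (MGraph n) λ D′ → Orientation D′ G × IsβOrientation D′ β × StronglyConnected D′
      extension isβ₁ sc₁ with orientation-↭ (↭-sym G↭fixed++rest) D-orients
      ... | D′ , D′-orients , D′↭D =
        D′ , D′-orients ,
        (λ x → subst (λ z → + 3 Unsigned.∣ z - β x) (sym (netDegree-↭ D′↭D x)) (D-isβ isβ₁ x)) ,
        (λ x y → DPath-⊆ (∈-resp-↭ (↭-sym D′↭D)) (D-stronglyConnected sc₁ x y))

    extend : (Σ (MGraph k) λ D₁ → Orientation D₁ G₁ × IsβOrientation D₁ β₁ × StronglyConnected D₁) →
      Σ (MGraph n) λ D → Orientation D G × IsβOrientation D β × StronglyConnected D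
    extend (D₁ , o₁ , isβ₁ , sc₁) with orientation-↭ edges (orientation-map ι o₁)
    ... | ab ∷ DA , ab-orients ∷ DA-orients , ab∷DA↭ = Extension.extension ab-orients DA-orients ab∷DA↭ isβ₁ sc₁

open Splits using (balancedSplit)
open Orientations using (adjacent⇒≢)

lemma2p12 : ∀ {n} (G : MGraph n) → Loopless G → EdgeConnected 4 G →
    (u v : Fin n) → Adjacent G u v → eOut G u v ≥ 3 →
    (a b : Fin n) → a ≢ u → a ≢ v → b ≢ u → b ≢ v → a ≢ b →
    Adjacent G v a → Adjacent G v b →
    ∀ {k} (ι : Fin k → Fin n) (G₁ : MGraph k) → IsDeleteAdd G u v a b ι G₁ →
    InS3 G₁ → InS3 G
lemma2p12 G loopless 4-edge-connected u v uv-adjacent eOut≥3 a b a≢u a≢v b≢u b≢v a≢b va-adjacent vb-adjacent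
          ι G₁ G₁-is G₁∈S₃ β β-zeroSum = extend (G₁∈S₃ β₁ (β₁-zeroSum β-zeroSum))
  where
  u≢v : u ≢ v
  u≢v = adjacent⇒≢ loopless uv-adjacent
  open Neighbourhood u v u≢v using (arrange; module Arranged)
  open Lift u≢v a≢u a≢v b≢u b≢v G₁-is (arrange G loopless)
            (Arranged.twoSpokes (arrange G loopless) a≢u a≢v b≢u b≢v a≢b va-adjacent vb-adjacent)
  open WithSplit β (balancedSplit (n%ℕd<d (β u) 3) (n%ℕd<d (β v) 3) m s r (admissible 4-edge-connected uv-adjacent eOut≥3))
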